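{- For every complete graph $K_n$ with $n\geq 3$, $\overline{\chi^t_{\Sigma}}(K_n)=3$, while $\overline{\chi^t_{\Sigma}}(K_2)=2$.
   Context: All graphs are finite, simple and undirected. A total $k$-colouring of a graph $G$ is any (not necessarily proper) map $\gamma_t:V(G)\cup E(G)\to\{1,\dots,k\}$; it induces the vertex colouring $\sigma^T(v)=\gamma_t(v)+\sum_{e\ni v}\gamma_t(e)$. It is neighbour-sum-distinguishing if $\sigma^T(u)\neq\sigma^T(v)$ for every edge $uv\in E(G)$. It is equitable if for any two colours $i,j\in\{1,\dots,k\}$ the numbers of elements of $V(G)\cup E(G)$ coloured $i$ and coloured $j$ differ by at most one. $\overline{\chi^t_{\Sigma}}(G)$ denotes the smallest $k$ such that $G$ admits an equitable neighbour-sum-distinguishing total $k$-colouring. -}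

module Defs where

open import Data.Nat using (ℕ; zero; suc; _+_; _≤_; _<_)
open import Data.Fin as Fin using (Fin; toℕ)
open import Data.Fin.Properties using (_≟_)
open import Data.List using (List; []; _∷_; length; filter; map; allFin; concatMap; lookup)
open import Data.Nat.ListAction using (sum)
open import Data.Product using (Σ; _×_; _,_; proj₁; proj₂)
open import Data.Sum using (_⊎_)
open import Relation.Nullary using (¬_; Dec; yes; no)
open import Relation.Nullary.Decidable using (_⊎-dec_)
open import Relation.Binary.PropositionalEquality using (_≡_; _≢_)

-- A finite simple graph with vertex set Fin n, given by its list of edges;
-- each edge {u,w} is listed exactly once as an ordered pair (u , w), u ≠ w.
record Graph : Set where
  field
    n : ℕ
    E : List (Fin n × Fin n)
open Graph public

m : Graph → ℕ
m G = length (E G)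

edge : (G : Graph) → Fin (m G) → Fin (n G) × Fin (n G)
edge G i = lookup (E G) i

K : ℕ → Graph
K N = record
  { n = N
  ; E = concatMap (λ i → map (λ j → (i , j)) (filter (λ j → i Fin.<? j) (allFin N))) (allFin N)
  }

-- A total k-colouring (not necessarily proper).  Colours are Fin k,
-- where c : Fin k stands for the colour suc (toℕ c) ∈ {1,…,k}.
-- Edges are indexed by their position in the edge list.
record TotalColouring (G : Graph) (k : ℕ) : Set where
  field
    vcol : Fin (n G) → Fin k
    ecol : Fin (m G) → Fin k
open TotalColouring public

val : ∀ {k} → Fin k → ℕ
val c = suc (toℕ c)

incident? : ∀ {N} (v : Fin N) (e : Fin N × Fin N) → Dec ((v ≡ proj₁ e) ⊎ (v ≡ proj₂ e))
incident? v e = (v ≟ proj₁ e) ⊎-dec (v ≟ proj₂ e)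

σT : ∀ {G k} → TotalColouring G k → Fin (n G) → ℕ
σT {G} γ v = val (vcol γ v)
  + sum (map (λ i → val (ecol γ i)) (filter (λ i → incident? v (edge G i)) (allFin (m G))))

NeighbourSumDistinguishing : ∀ {G k} → TotalColouring G k → Set
NeighbourSumDistinguishing {G} γ =
  ∀ (i : Fin (m G)) → σT γ (proj₁ (edge G i)) ≢ σT γ (proj₂ (edge G i))

count : ∀ {G k} → TotalColouring G k → Fin k → ℕ
count {G} γ c =
  length (filter (λ v → vcol γ v ≟ c) (allFin (n G)))
  + length (filter (λ i → ecol γ i ≟ c) (allFin (m G)))

Equitable : ∀ {G k} → TotalColouring G k → Set
Equitable {G} {k} γ = ∀ (c d : Fin k) → count γ c ≤ suc (count γ d)

AdmitsENSDT : Graph → ℕ → Set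
AdmitsENSDT G k =
  Σ (TotalColouring G k) (λ γ → NeighbourSumDistinguishing γ × Equitable γ)

EquitableNSDTotalChromatic : Graph → ℕ → Set
EquitableNSDTotalChromatic G k =
  AdmitsENSDT G k × (∀ (j : ℕ) → j < k → ¬ AdmitsENSDT G j)

module Submission where

open import Defs
open import Data.Nat using (ℕ; _≤_)
open import Data.Product using (_×_)

-- K_2, K_3, K_4 are coloured explicitly (checked by evaluation).
-- For N ≥ 5 a total colouring of K_N is a symmetric N × N colour matrix whose
-- diagonal colours the vertices (mkCol); σ^T(v) is then the column sum of v.
-- Split ⌊N(N+1)/6⌋ = F t + p, where F t counts the cells i ≤ j with i + j < t.
-- Colour 1 goes to the staircase i + j < t plus p anti-diagonal pairs
-- (Staircase), colour 3 to its mirror image in the opposite corner, colour 2 to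
-- the rest; the classes then have sizes F t + p, F t + p + δ, F t + p with
-- δ ≤ 1 (StaircaseCounting, Parameters).  Column counts of a staircase are
-- non-increasing and drop at all but a few columns, which makes σ strictly
-- increasing along the labels (Monotonicity, Construction).
--
-- For 2 colours, σ(v) = N + d(v)
-- with d injective into [0, N] since K_N is complete; counting Σ d against the
-- equitability of the classes rules out both possible missing values
-- (Pigeonhole, TwoColourLowerBound).

module Summation where

  open import Data.Nat
  open import Data.Nat.Properties
  open import Data.Bool using (Bool; true; false)
  open import Data.Fin as Fin using (Fin; toℕ)
  open import Data.Fin.Properties using () renaming (_≟_ to _≟F_)
  open import Data.List using (List; []; _∷_; _++_; length; filter; map; allFin; tabulate; lookup; concat; concatMap)
  open import Data.List.Properties using (map-tabulate; map-++)
  open import Data.Nat.ListAction using (sum)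
  open import Data.Nat.ListAction.Properties using (sum-++)
  open import Data.Empty using (⊥-elim)
  open import Relation.Nullary using (Dec; yes; no; does; ¬_)
  open import Relation.Unary using (Pred; Decidable)
  open import Relation.Binary.PropositionalEquality
  open import Function using (_∘_)
  open import Algebra.Properties.CommutativeMonoid.Sum +-0-commutativeMonoid
    using (sum-cong-≗; ∑-distrib-+; ∑-comm) renaming (sum to ∑)

  -- sel b x keeps x when b holds and is 0 otherwise; 'sel (does d) x' is the
  -- arithmetic form of an Iverson bracket [P]·x, so filtered sums become plain sums.
  sel : Bool → ℕ → ℕ
  sel true n = n
  sel false _ = 0

  b2n : Bool → ℕ
  b2n b = sel b 1

  sel-≤ : ∀ b n → sel b n ≤ n
  sel-≤ true n = ≤-refl
  sel-≤ false n = z≤n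

  b2n≤1 : ∀ b → b2n b ≤ 1
  b2n≤1 b = sel-≤ b 1

  sel-yes : ∀ {P : Set} (d : Dec P) x → P → sel (does d) x ≡ x
  sel-yes (yes p) x _ = refl
  sel-yes (no ¬p) x p = ⊥-elim (¬p p)

  sel-no : ∀ {P : Set} (d : Dec P) x → ¬ P → sel (does d) x ≡ 0
  sel-no (yes p) x ¬p = ⊥-elim (¬p p)
  sel-no (no _) x ¬p = refl

  sel-+ : ∀ b x y → sel b (x + y) ≡ sel b x + sel b y
  sel-+ true x y = refl
  sel-+ false x y = refl

  sel-zero : ∀ b → sel b 0 ≡ 0
  sel-zero true = refl
  sel-zero false = refl

  doesEq : ∀ {A B : Set} (d1 : Dec A) (d2 : Dec B) → (A → B) → (B → A) → does d1 ≡ does d2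
  doesEq (yes _) (yes _) f g = refl
  doesEq (no _) (no _) f g = refl
  doesEq (yes a) (no nb) f g = ⊥-elim (nb (f a))
  doesEq (no na) (yes b) f g = ⊥-elim (na (g b))

  S : (n : ℕ) → (Fin n → ℕ) → ℕ
  S n f = ∑ f

  S-const : ∀ n c → S n (λ _ → c) ≡ n * c
  S-const zero c = refl
  S-const (suc n) c = cong (c +_) (S-const n c)

  S-zero : ∀ n → S n (λ _ → 0) ≡ 0
  S-zero n = trans (S-const n 0) (*-zeroʳ n)

  S-zero-each : ∀ n (f : Fin n → ℕ) → S n f ≡ 0 → ∀ i → f i ≡ 0
  S-zero-each (suc n) f e Fin.zero = m+n≡0⇒m≡0 (f Fin.zero) e
  S-zero-each (suc n) f e (Fin.suc i) = S-zero-each n (f ∘ Fin.suc) (m+n≡0⇒n≡0 (f Fin.zero) e) i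

  δ : ∀ {n} → Fin n → Fin n → ℕ → ℕ
  δ i a x = sel (does (i ≟F a)) x

  S-δ : ∀ n (a : Fin n) (f : Fin n → ℕ) → S n (λ i → δ i a (f i)) ≡ f a
  S-δ (suc n) Fin.zero f = trans (cong (f Fin.zero +_) (S-zero n)) (+-identityʳ _)
  S-δ (suc n) (Fin.suc a) f = trans (sum-cong-≗ lem) (S-δ n a (f ∘ Fin.suc))
    where
    lem : ∀ i → δ (Fin.suc i) (Fin.suc a) (f (Fin.suc i)) ≡ δ i a (f (Fin.suc i))
    lem i with i ≟F a
    ... | yes _ = refl
    ... | no _ = refl

  sum-allFin : ∀ n (f : Fin n → ℕ) → sum (map f (allFin n)) ≡ S n f
  sum-allFin n f = trans (cong sum (map-tabulate (λ i → i) f)) (sum-tabulate n f)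
    where
    sum-tabulate : ∀ n (g : Fin n → ℕ) → sum (tabulate g) ≡ S n g
    sum-tabulate zero g = refl
    sum-tabulate (suc n) g = cong (g Fin.zero +_) (sum-tabulate n (g ∘ Fin.suc))

  sum-filter : ∀ {A : Set} {p} {P : Pred A p} (P? : Decidable P) (f : A → ℕ) xs →
    sum (map f (filter P? xs)) ≡ sum (map (λ x → sel (does (P? x)) (f x)) xs)
  sum-filter P? f [] = refl
  sum-filter P? f (x ∷ xs) with does (P? x)
  ... | true = cong (f x +_) (sum-filter P? f xs)
  ... | false = sum-filter P? f xs

  length-filter : ∀ {A : Set} {p} {P : Pred A p} (P? : Decidable P) xs →
    length (filter P? xs) ≡ sum (map (λ x → sel (does (P? x)) 1) xs)
  length-filter P? [] = refl
  length-filter P? (x ∷ xs) with does (P? x)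
  ... | true = cong suc (length-filter P? xs)
  ... | false = length-filter P? xs

  sum-lookup : ∀ {A : Set} (L : List A) (f : A → ℕ) → S (length L) (λ i → f (lookup L i)) ≡ sum (map f L)
  sum-lookup [] f = refl
  sum-lookup (x ∷ L) f = cong (f x +_) (sum-lookup L f)

  sum-concatMap : ∀ {A B : Set} (f : B → ℕ) (g : A → List B) xs →
    sum (map f (concatMap g xs)) ≡ sum (map (λ x → sum (map f (g x))) xs)
  sum-concatMap f g [] = refl
  sum-concatMap f g (x ∷ xs) = begin
    sum (map f (g x ++ concat (map g xs)))              ≡⟨ cong sum (map-++ f (g x) _) ⟩
    sum (map f (g x) ++ map f (concat (map g xs)))      ≡⟨ sum-++ (map f (g x)) _ ⟩
    sum (map f (g x)) + sum (map f (concatMap g xs))    ≡⟨ cong (sum (map f (g x)) +_) (sum-concatMap f g xs) ⟩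
    sum (map f (g x)) + sum (map (λ y → sum (map f (g y))) xs) ∎
    where
    open ≡-Reasoning

  -- The explicit
  -- construction for K_n is arithmetic in the vertex labels 0,…,n-1, so it is
  -- carried out with R, which agrees with the library sum reindexed along toℕ.
  R : ℕ → (ℕ → ℕ) → ℕ
  R zero g = 0
  R (suc n) g = g 0 + R n (g ∘ suc)

  R≡S : ∀ n g → R n g ≡ S n (g ∘ toℕ)
  R≡S zero g = refl
  R≡S (suc n) g = cong (g 0 +_) (R≡S n (g ∘ suc))

  R-ext : ∀ n {f g : ℕ → ℕ} → (∀ i → i < n → f i ≡ g i) → R n f ≡ R n g
  R-ext zero e = refl
  R-ext (suc n) e = cong₂ _+_ (e 0 z<s) (R-ext n (λ i i<n → e (suc i) (s<s i<n)))

  R-+ : ∀ n (f g : ℕ → ℕ) → R n (λ i → f i + g i) ≡ R n f + R n g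
  R-+ n f g = begin
    R n (λ i → f i + g i)           ≡⟨ R≡S n _ ⟩
    S n (λ i → f (toℕ i) + g (toℕ i)) ≡⟨ ∑-distrib-+ {n} (f ∘ toℕ) (g ∘ toℕ) ⟩
    S n (f ∘ toℕ) + S n (g ∘ toℕ)   ≡⟨ sym (cong₂ _+_ (R≡S n f) (R≡S n g)) ⟩
    R n f + R n g                   ∎
    where open ≡-Reasoning

  R-swap : ∀ n k (f : ℕ → ℕ → ℕ) → R n (λ i → R k (λ j → f i j)) ≡ R k (λ j → R n (λ i → f i j))
  R-swap n k f = begin
    R n (λ i → R k (λ j → f i j))                   ≡⟨ trans (R≡S n _) (sum-cong-≗ {n} (λ i → R≡S k _)) ⟩
    S n (λ i → S k (λ j → f (toℕ i) (toℕ j)))       ≡⟨ ∑-comm {n} {k} (λ i j → f (toℕ i) (toℕ j)) ⟩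
    S k (λ j → S n (λ i → f (toℕ i) (toℕ j)))       ≡⟨ sym (trans (R≡S k _) (sum-cong-≗ {k} (λ j → R≡S n _))) ⟩
    R k (λ j → R n (λ i → f i j))                   ∎
    where open ≡-Reasoning

  R-const : ∀ n c → R n (λ _ → c) ≡ n * c
  R-const n c = trans (R≡S n _) (S-const n c)

  R-zero : ∀ n → R n (λ _ → 0) ≡ 0
  R-zero n = trans (R-const n 0) (*-zeroʳ n)

  R-sel : ∀ n b (f : ℕ → ℕ) → R n (λ j → sel b (f j)) ≡ sel b (R n f)
  R-sel n true f = refl
  R-sel n false f = R-zero n

  R-top : ∀ n g → R (suc n) g ≡ R n g + g n
  R-top zero g = +-comm (g 0) 0
  R-top (suc n) g = trans (cong (g 0 +_) (R-top n (g ∘ suc))) (sym (+-assoc (g 0) _ _))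

  R-rev : ∀ N (g : ℕ → ℕ) → R N (λ u → g (N ∸ 1 ∸ u)) ≡ R N g
  R-rev zero g = refl
  R-rev (suc zero) g = refl
  R-rev (suc (suc n)) g = begin
    g (suc n) + R (suc n) (λ u → g (n ∸ u)) ≡⟨ cong (g (suc n) +_) (R-rev (suc n) g) ⟩
    g (suc n) + R (suc n) g                 ≡⟨ +-comm (g (suc n)) _ ⟩
    R (suc n) g + g (suc n)                 ≡⟨ sym (R-top (suc n) g) ⟩
    R (suc (suc n)) g                       ∎
    where open ≡-Reasoning

  R-δ : ∀ n a (g : ℕ → ℕ) → a < n → R n (λ i → sel (does (i ≟ a)) (g i)) ≡ g a
  R-δ (suc n) zero g _ = trans (cong (g 0 +_) (trans (R-ext n (λ i _ → refl)) (R-zero n))) (+-identityʳ _)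
  R-δ (suc n) (suc a) g (s≤s a<n) = R-δ n a (g ∘ suc) a<n

  R-lt : ∀ N c → c ≤ N → R N (λ u → b2n (does (u <? c))) ≡ c
  R-lt zero .zero z≤n = refl
  R-lt (suc N) zero _ = R-zero (suc N)
  R-lt (suc N) (suc c) (s≤s c≤N) = cong suc (R-lt N c c≤N)

  R²≡S² : ∀ n (G : ℕ → ℕ → ℕ) → R n (λ i → R n (λ j → G i j)) ≡ S n (λ i → S n (λ j → G (toℕ i) (toℕ j)))
  R²≡S² n G = trans (R≡S n _) (sum-cong-≗ {n} (λ i → R≡S n _))

module CompleteGraph where

  open import Data.Nat
  open import Data.Nat.Properties
  open import Data.Bool using (_∨_)
  open import Data.Fin as Fin using (Fin; toℕ)
  open import Data.Fin.Properties using (toℕ-injective; toℕ<n) renaming (_≟_ to _≟F_; <-cmp to <-cmpF)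
  open import Data.List using (List; map; filter; allFin)
  open import Data.List.Properties using (map-∘)
  open import Data.List.Membership.Propositional using (_∈_)
  open import Data.List.Membership.Propositional.Properties
    using (∈-concatMap⁺; ∈-concatMap⁻; ∈-map⁺; ∈-map⁻; ∈-filter⁺; ∈-filter⁻; ∈-allFin; ∈-lookup)
  open import Data.List.Relation.Unary.Any as Any using (satisfied)
  open import Data.List.Relation.Unary.Any.Properties using (lookup-index)
  open import Data.Nat.ListAction using (sum)
  open import Data.Product using (Σ; _×_; _,_; proj₁; proj₂)
  open import Data.Sum using (_⊎_; inj₁; inj₂)
  open import Data.Empty using (⊥-elim)
  open import Relation.Nullary using (Dec; yes; no; does)
  open import Relation.Binary using (tri<; tri≈; tri>)
  open import Relation.Binary.PropositionalEquality
  open import Algebra.Properties.CommutativeMonoid.Sum +-0-commutativeMonoid using (sum-cong-≗; ∑-distrib-+)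
  open import Defs
  open Summation

  row : (N : ℕ) → Fin N → List (Fin N × Fin N)
  row N i = map (λ j → (i , j)) (filter (λ j → i Fin.<? j) (allFin N))

  ∈-edges⁺ : ∀ {N} {i j : Fin N} → i Fin.< j → (i , j) ∈ E (K N)
  ∈-edges⁺ {N} {i} {j} i<j =
    ∈-concatMap⁺ (row N) (Any.map (λ { refl → ∈-map⁺ (i ,_) (∈-filter⁺ (i Fin.<?_) (∈-allFin j) i<j) }) (∈-allFin i))

  ∈-edges⁻ : ∀ {N} {y : Fin N × Fin N} → y ∈ E (K N) → proj₁ y Fin.< proj₂ y
  ∈-edges⁻ {N} y∈E with satisfied (∈-concatMap⁻ (row N) {xs = allFin N} y∈E)
  ... | i , y∈row with ∈-map⁻ (i ,_) {xs = filter (i Fin.<?_) (allFin N)} y∈row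
  ...   | j , j∈filter , refl = proj₂ (∈-filter⁻ (i Fin.<?_) {xs = allFin N} j∈filter)

  edge-lt : ∀ N e → toℕ (proj₁ (edge (K N) e)) < toℕ (proj₂ (edge (K N) e))
  edge-lt N e = ∈-edges⁻ (∈-lookup e)

  endsDistinct : ∀ N e → proj₁ (edge (K N) e) ≢ proj₂ (edge (K N) e)
  endsDistinct N e x = <-irrefl (cong toℕ x) (edge-lt N e)

  Conn : ∀ N → Fin N → Fin N → Fin (m (K N)) → Set
  Conn N a b e = (proj₁ (edge (K N) e) ≡ a × proj₂ (edge (K N) e) ≡ b)
               ⊎ (proj₁ (edge (K N) e) ≡ b × proj₂ (edge (K N) e) ≡ a)

  edgeIndex : ∀ {N} {i j : Fin N} → i Fin.< j → Σ (Fin (m (K N))) λ e → edge (K N) e ≡ (i , j)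
  edgeIndex i<j = Any.index (∈-edges⁺ i<j) , sym (lookup-index (∈-edges⁺ i<j))

  edgeBetween : ∀ N (a b : Fin N) → a ≢ b → Σ (Fin (m (K N))) (Conn N a b)
  edgeBetween N a b ne with <-cmpF a b
  ... | tri< a<b _ _ = let e , eq = edgeIndex a<b in e , inj₁ (cong proj₁ eq , cong proj₂ eq)
  ... | tri≈ _ a≡b _ = ⊥-elim (ne a≡b)
  ... | tri> _ _ b<a = let e , eq = edgeIndex b<a in e , inj₂ (cong proj₁ eq , cong proj₂ eq)

  sumEdges : ∀ N (ψ : Fin N × Fin N → ℕ) →
    S (m (K N)) (λ e → ψ (edge (K N) e)) ≡ S N (λ i → S N (λ j → sel (does (i Fin.<? j)) (ψ (i , j))))
  sumEdges N ψ = begin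
    S (m (K N)) (λ e → ψ (edge (K N) e))           ≡⟨ sum-lookup (E (K N)) ψ ⟩
    sum (map ψ (E (K N)))                           ≡⟨ sum-concatMap ψ (row N) (allFin N) ⟩
    sum (map (λ i → sum (map ψ (row N i))) (allFin N)) ≡⟨ sum-allFin N _ ⟩
    S N (λ i → sum (map ψ (row N i)))               ≡⟨ sum-cong-≗ rowSum ⟩
    S N (λ i → S N (λ j → sel (does (i Fin.<? j)) (ψ (i , j)))) ∎
    where
    open ≡-Reasoning
    rowSum : ∀ i → sum (map ψ (row N i)) ≡ S N (λ j → sel (does (i Fin.<? j)) (ψ (i , j)))
    rowSum i = begin
      sum (map ψ (row N i))                                           ≡⟨ cong sum (sym (map-∘ (filter (i Fin.<?_) (allFin N)))) ⟩
      sum (map (λ j → ψ (i , j)) (filter (i Fin.<?_) (allFin N)))     ≡⟨ sum-filter (i Fin.<?_) (λ j → ψ (i , j)) (allFin N) ⟩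
      sum (map (λ j → sel (does (i Fin.<? j)) (ψ (i , j))) (allFin N)) ≡⟨ sum-allFin N _ ⟩
      S N (λ j → sel (does (i Fin.<? j)) (ψ (i , j)))                 ∎

  sumEdgesℕ : ∀ N (φ : ℕ → ℕ → ℕ) →
    S (m (K N)) (λ e → φ (toℕ (proj₁ (edge (K N) e))) (toℕ (proj₂ (edge (K N) e))))
      ≡ R N (λ i → R N (λ j → sel (does (i <? j)) (φ i j)))
  sumEdgesℕ N φ = trans (sumEdges N (λ e → φ (toℕ (proj₁ e)) (toℕ (proj₂ e)))) (sym (R²≡S² N (λ i j → sel (does (i <? j)) (φ i j))))

  -- Pointwise identity behind 'incidentSum': for i < j the pair {i,j} is counted at
  -- v exactly when v = i or v = j (and not both).
  incidentSplit : ∀ {i j v : ℕ} (dl : Dec (i < j)) (a : Dec (v ≡ i)) (b : Dec (v ≡ j)) (a' : Dec (i ≡ v)) (b' : Dec (j ≡ v)) x →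
    sel (does dl) (sel (does a ∨ does b) x) ≡ sel (does a') (sel (does dl) x) + sel (does b') (sel (does dl) x)
  incidentSplit (no _) a b a' b' x = sym (cong₂ _+_ (sel-zero (does a')) (sel-zero (does b')))
  incidentSplit (yes i<j) (yes refl) b (yes _) (yes refl) x = ⊥-elim (<-irrefl refl i<j)
  incidentSplit (yes i<j) (yes refl) b (yes _) (no _) x = sym (+-identityʳ x)
  incidentSplit (yes i<j) (yes refl) b (no ne) b' x = ⊥-elim (ne refl)
  incidentSplit (yes i<j) (no ne) (yes refl) (yes refl) b' x = ⊥-elim (ne refl)
  incidentSplit (yes i<j) (no ne) (yes refl) (no _) (yes _) x = refl
  incidentSplit (yes i<j) (no ne) (yes refl) (no _) (no ne') x = ⊥-elim (ne' refl)
  incidentSplit (yes i<j) (no ne) (no ne2) (yes refl) b' x = ⊥-elim (ne refl)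
  incidentSplit (yes i<j) (no ne) (no ne2) (no _) (yes refl) x = ⊥-elim (ne2 refl)
  incidentSplit (yes i<j) (no ne) (no ne2) (no _) (no _) x = refl

  trichotomySplit : ∀ {u v : ℕ} (d1 : Dec (v < u)) (d2 : Dec (u < v)) (d3 : Dec (u ≡ v)) x →
    sel (does d1) x + sel (does d2) x + sel (does d3) x ≡ x
  trichotomySplit (yes p) (yes q) d3 x = ⊥-elim (<-asym p q)
  trichotomySplit (yes p) (no _) (yes refl) x = ⊥-elim (<-irrefl refl p)
  trichotomySplit (yes p) (no _) (no _) x = trans (+-identityʳ _) (+-identityʳ x)
  trichotomySplit (no _) (yes q) (yes refl) x = ⊥-elim (<-irrefl refl q)
  trichotomySplit (no _) (yes q) (no _) x = +-identityʳ x
  trichotomySplit (no _) (no _) (yes _) x = refl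
  trichotomySplit {u} {v} (no a) (no b) (no c) x with <-cmp u v
  ... | tri< p _ _ = ⊥-elim (b p)
  ... | tri≈ _ p _ = ⊥-elim (c p)
  ... | tri> _ _ p = ⊥-elim (a p)

  pairSum : ∀ N (φ : ℕ → ℕ → ℕ) → (∀ i j → φ i j ≡ φ j i) → ∀ v → v < N →
    R N (λ i → R N (λ j → sel (does (i <? j)) (sel (does (v ≟ i) ∨ does (v ≟ j)) (φ i j)))) + φ v v ≡ R N (λ u → φ u v)
  pairSum N φ φ-sym v v<N = begin
    R N (λ i → R N (λ j → sel (does (i <? j)) (sel (does (v ≟ i) ∨ does (v ≟ j)) (φ i j)))) + φ v v
      ≡⟨ cong (_+ φ v v) (R-ext N (λ i _ → R-ext N (λ j _ → incidentSplit (i <? j) (v ≟ i) (v ≟ j) (i ≟ v) (j ≟ v) (φ i j)))) ⟩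
    R N (λ i → R N (λ j → sel (does (i ≟ v)) (sel (does (i <? j)) (φ i j)) + sel (does (j ≟ v)) (sel (does (i <? j)) (φ i j)))) + φ v v
      ≡⟨ cong (_+ φ v v) (trans (R-ext N (λ i _ → R-+ N _ _)) (R-+ N _ _)) ⟩
    R N (λ i → R N (λ j → sel (does (i ≟ v)) (sel (does (i <? j)) (φ i j)))) + R N (λ i → R N (λ j → sel (does (j ≟ v)) (sel (does (i <? j)) (φ i j)))) + φ v v
      ≡⟨ cong (_+ φ v v) (cong₂ _+_ rowOfV columnOfV) ⟩
    R N (λ j → sel (does (v <? j)) (φ v j)) + R N (λ i → sel (does (i <? v)) (φ i v)) + φ v v
      ≡⟨ cong₂ _+_ (cong (_+ R N (λ i → sel (does (i <? v)) (φ i v))) (R-ext N (λ j _ → cong (sel (does (v <? j))) (φ-sym v j)))) (sym (R-δ N v (λ u → φ u v) v<N)) ⟩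
    R N (λ j → sel (does (v <? j)) (φ j v)) + R N (λ i → sel (does (i <? v)) (φ i v)) + R N (λ u → sel (does (u ≟ v)) (φ u v))
      ≡⟨ cong (_+ R N (λ u → sel (does (u ≟ v)) (φ u v))) (sym (R-+ N _ _)) ⟩
    R N (λ u → sel (does (v <? u)) (φ u v) + sel (does (u <? v)) (φ u v)) + R N (λ u → sel (does (u ≟ v)) (φ u v))
      ≡⟨ sym (R-+ N _ _) ⟩
    R N (λ u → sel (does (v <? u)) (φ u v) + sel (does (u <? v)) (φ u v) + sel (does (u ≟ v)) (φ u v))
      ≡⟨ R-ext N (λ u _ → trichotomySplit (v <? u) (u <? v) (u ≟ v) (φ u v)) ⟩
    R N (λ u → φ u v) ∎
    where
    open ≡-Reasoning
    rowOfV : R N (λ i → R N (λ j → sel (does (i ≟ v)) (sel (does (i <? j)) (φ i j)))) ≡ R N (λ j → sel (does (v <? j)) (φ v j))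
    rowOfV = trans (R-ext N (λ i _ → R-sel N (does (i ≟ v)) _)) (R-δ N v (λ i → R N (λ j → sel (does (i <? j)) (φ i j))) v<N)
    columnOfV : R N (λ i → R N (λ j → sel (does (j ≟ v)) (sel (does (i <? j)) (φ i j)))) ≡ R N (λ i → sel (does (i <? v)) (φ i v))
    columnOfV = R-ext N (λ i _ → R-δ N v (λ j → sel (does (i <? j)) (φ i j)) v<N)

  incidentSum : ∀ N (φ : ℕ → ℕ → ℕ) → (∀ i j → φ i j ≡ φ j i) → (v : Fin N) →
    S (m (K N)) (λ e → sel (does (incident? v (edge (K N) e))) (φ (toℕ (proj₁ (edge (K N) e))) (toℕ (proj₂ (edge (K N) e)))))
      + φ (toℕ v) (toℕ v)
    ≡ R N (λ u → φ u (toℕ v))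
  incidentSum N φ φ-sym v = begin
    S (m (K N)) (λ e → ψ (edge (K N) e)) + φ (toℕ v) (toℕ v)
      ≡⟨ cong (_+ φ (toℕ v) (toℕ v)) (sumEdges N ψ) ⟩
    S N (λ i → S N (λ j → sel (does (i Fin.<? j)) (ψ (i , j)))) + φ (toℕ v) (toℕ v)
      ≡⟨ cong (_+ φ (toℕ v) (toℕ v)) (sum-cong-≗ (λ i → sum-cong-≗ (λ j →
           cong (λ b → sel (does (i Fin.<? j)) (sel b (φ (toℕ i) (toℕ j)))) (cong₂ _∨_ (sameTest v i) (sameTest v j))))) ⟩
    S N (λ i → S N (λ j → sel (does (toℕ i <? toℕ j)) (sel (does (toℕ v ≟ toℕ i) ∨ does (toℕ v ≟ toℕ j)) (φ (toℕ i) (toℕ j))))) + φ (toℕ v) (toℕ v)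
      ≡⟨ cong (_+ φ (toℕ v) (toℕ v)) (sym (R²≡S² N (λ i j → sel (does (i <? j)) (sel (does (toℕ v ≟ i) ∨ does (toℕ v ≟ j)) (φ i j))))) ⟩
    R N (λ i → R N (λ j → sel (does (i <? j)) (sel (does (toℕ v ≟ i) ∨ does (toℕ v ≟ j)) (φ i j)))) + φ (toℕ v) (toℕ v)
      ≡⟨ pairSum N φ φ-sym (toℕ v) (toℕ<n v) ⟩
    R N (λ u → φ u (toℕ v)) ∎
    where
    open ≡-Reasoning
    ψ : Fin N × Fin N → ℕ
    ψ e = sel (does (incident? v e)) (φ (toℕ (proj₁ e)) (toℕ (proj₂ e)))
    sameTest : ∀ (a b : Fin N) → does (a ≟F b) ≡ does (toℕ a ≟ toℕ b)
    sameTest a b = doesEq (a ≟F b) (toℕ a ≟ toℕ b) (cong toℕ) toℕ-injective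

  incS : ∀ N → Fin N → Fin (m (K N)) → ℕ → ℕ
  incS N v e = sel (does (incident? v (edge (K N) e)))

  deg : ∀ N → Fin N → ℕ
  deg N v = S (m (K N)) (λ e → incS N v e 1)

  deg+1 : ∀ N v → suc (deg N v) ≡ N
  deg+1 N v = trans (+-comm 1 (deg N v)) (trans (incidentSum N (λ _ _ → 1) (λ _ _ → refl) v) (trans (R-const N 1) (*-identityʳ N)))

  endsSum : ∀ N e c → S N (λ v → incS N v e c) ≡ c + c
  endsSum N e c = begin
    S N (λ v → incS N v e c)                                  ≡⟨ sum-cong-≗ (λ v → orSplit (v ≟F a) (v ≟F b) (endsDistinct N e)) ⟩
    S N (λ v → δ v a c + δ v b c)                             ≡⟨ ∑-distrib-+ {N} (λ v → δ v a c) (λ v → δ v b c) ⟩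
    S N (λ v → δ v a c) + S N (λ v → δ v b c)                 ≡⟨ cong₂ _+_ (S-δ N a (λ _ → c)) (S-δ N b (λ _ → c)) ⟩
    c + c ∎
    where
    open ≡-Reasoning
    a b : Fin N
    a = proj₁ (edge (K N) e)
    b = proj₂ (edge (K N) e)
    orSplit : ∀ {v x y : Fin N} (d1 : Dec (v ≡ x)) (d2 : Dec (v ≡ y)) → x ≢ y → sel (does d1 ∨ does d2) c ≡ sel (does d1) c + sel (does d2) c
    orSplit (yes refl) (yes refl) ne = ⊥-elim (ne refl)
    orSplit (yes _) (no _) ne = sym (+-identityʳ c)
    orSplit (no _) (yes _) ne = refl
    orSplit (no _) (no _) ne = refl

  connInc : ∀ {N a b e} → Conn N a b e → incS N a e 1 ≡ 1
  connInc {N} {a} {b} {e} (inj₁ (p , q)) = sel-yes (incident? a (edge (K N) e)) 1 (inj₁ (sym p))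
  connInc {N} {a} {b} {e} (inj₂ (p , q)) = sel-yes (incident? a (edge (K N) e)) 1 (inj₂ (sym q))

  connSym : ∀ {N a b e} → Conn N a b e → Conn N b a e
  connSym (inj₁ x) = inj₂ x
  connSym (inj₂ x) = inj₁ x

  connDiff : ∀ {N a b c e e'} → Conn N a b e → Conn N b c e' → a ≢ c → b ≢ a → e ≢ e'
  connDiff (inj₁ (p , q)) (inj₁ (p' , q')) ac ba refl = ba (trans (sym p') p)
  connDiff (inj₁ (p , q)) (inj₂ (p' , q')) ac ba refl = ac (trans (sym p) p')
  connDiff (inj₂ (p , q)) (inj₁ (p' , q')) ac ba refl = ac (trans (sym q) q')
  connDiff (inj₂ (p , q)) (inj₂ (p' , q')) ac ba refl = ba (trans (sym q') q)

module Colourings where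

  open import Data.Nat
  open import Data.Nat.Properties
  open import Data.Fin as Fin using (Fin; toℕ)
  open import Data.Fin.Properties using () renaming (_≟_ to _≟F_)
  open import Data.List using (allFin)
  open import Data.Product using (proj₁; proj₂)
  open import Data.Empty using (⊥-elim)
  open import Relation.Nullary using (Dec; yes; no; does)
  open import Relation.Binary.PropositionalEquality
  open import Defs
  open Summation
  open CompleteGraph

  sigmaS : ∀ {G k} (γ : TotalColouring G k) v →
    σT γ v ≡ val (vcol γ v) + S (m G) (λ e → sel (does (incident? v (edge G e))) (val (ecol γ e)))
  sigmaS {G} γ v = cong (val (vcol γ v) +_)
    (trans (sum-filter (λ i → incident? v (edge G i)) (λ i → val (ecol γ i)) (allFin (m G))) (sum-allFin (m G) _))

  ind : ∀ {k} → Fin k → Fin k → ℕ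
  ind a c = sel (does (a ≟F c)) 1

  countS : ∀ {G k} (γ : TotalColouring G k) c →
    count γ c ≡ S (n G) (λ v → ind (vcol γ v) c) + S (m G) (λ e → ind (ecol γ e) c)
  countS {G} γ c = cong₂ _+_
    (trans (length-filter (λ v → vcol γ v ≟F c) (allFin (n G))) (sum-allFin (n G) _))
    (trans (length-filter (λ e → ecol γ e ≟F c) (allFin (m G))) (sum-allFin (m G) _))

  mkCol : ∀ N k → (ℕ → ℕ → Fin k) → TotalColouring (K N) k
  mkCol N k col = record
    { vcol = λ v → col (toℕ v) (toℕ v)
    ; ecol = λ e → col (toℕ (proj₁ (edge (K N) e))) (toℕ (proj₂ (edge (K N) e))) }

  σ-mk : ∀ N k (col : ℕ → ℕ → Fin k) → (∀ i j → col i j ≡ col j i) → ∀ v →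
    σT (mkCol N k col) v ≡ R N (λ u → val (col u (toℕ v)))
  σ-mk N k col col-sym v = begin
    σT γ v                                     ≡⟨ sigmaS γ v ⟩
    val (col (toℕ v) (toℕ v)) + edgesAtV       ≡⟨ +-comm (val (col (toℕ v) (toℕ v))) edgesAtV ⟩
    edgesAtV + val (col (toℕ v) (toℕ v))       ≡⟨ incidentSum N (λ i j → val (col i j)) (λ i j → cong val (col-sym i j)) v ⟩
    R N (λ u → val (col u (toℕ v)))            ∎
    where
    open ≡-Reasoning
    γ : TotalColouring (K N) k
    γ = mkCol N k col
    edgesAtV : ℕ
    edgesAtV = S (m (K N)) (λ e → sel (does (incident? v (edge (K N) e))) (val (ecol γ e)))

  leSplit : ∀ {i j : ℕ} (d1 : Dec (i ≤ j)) (d2 : Dec (i < j)) (d3 : Dec (j ≡ i)) x → sel (does d1) x ≡ sel (does d2) x + sel (does d3) x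
  leSplit (yes a) (yes b) (yes refl) x = ⊥-elim (<-irrefl refl b)
  leSplit (yes a) (yes b) (no _) x = sym (+-identityʳ x)
  leSplit (yes a) (no b) (yes _) x = refl
  leSplit (yes a) (no b) (no c) x = ⊥-elim (c (sym (≤-antisym a (≮⇒≥ b))))
  leSplit (no a) (yes b) d3 x = ⊥-elim (a (<⇒≤ b))
  leSplit (no a) (no b) (yes refl) x = ⊥-elim (a ≤-refl)
  leSplit (no a) (no b) (no _) x = refl

  count-mk : ∀ N k (col : ℕ → ℕ → Fin k) c →
    count (mkCol N k col) c ≡ R N (λ i → R N (λ j → sel (does (i ≤? j)) (ind (col i j) c)))
  count-mk N k col c = begin
    count γ c
      ≡⟨ countS γ c ⟩
    S N (λ v → ind (col (toℕ v) (toℕ v)) c) + S (m (K N)) (λ e → ind (ecol γ e) c)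
      ≡⟨ cong₂ _+_ (sym (R≡S N (λ v → ind (col v v) c))) (sumEdgesℕ N (λ i j → ind (col i j) c)) ⟩
    R N (λ i → ind (col i i) c) + R N (λ i → R N (λ j → sel (does (i <? j)) (ind (col i j) c)))
      ≡⟨ +-comm (R N (λ i → ind (col i i) c)) _ ⟩
    R N (λ i → R N (λ j → sel (does (i <? j)) (ind (col i j) c))) + R N (λ i → ind (col i i) c)
      ≡⟨ sym (R-+ N _ _) ⟩
    R N (λ i → R N (λ j → sel (does (i <? j)) (ind (col i j) c)) + ind (col i i) c)
      ≡⟨ R-ext N (λ i i<N → sym (rowWithDiagonal i i<N)) ⟩
    R N (λ i → R N (λ j → sel (does (i ≤? j)) (ind (col i j) c))) ∎
    where
    open ≡-Reasoning
    γ : TotalColouring (K N) k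
    γ = mkCol N k col
    rowWithDiagonal : ∀ i → i < N →
      R N (λ j → sel (does (i ≤? j)) (ind (col i j) c)) ≡ R N (λ j → sel (does (i <? j)) (ind (col i j) c)) + ind (col i i) c
    rowWithDiagonal i i<N = trans (R-ext N (λ j _ → leSplit (i ≤? j) (i <? j) (j ≟ i) (ind (col i j) c)))
      (trans (R-+ N _ _) (cong (R N (λ j → sel (does (i <? j)) (ind (col i j) c)) +_) (R-δ N i (λ j → ind (col i j) c) i<N)))

  -- Tr N = N(N+1)/2 = |V(K_N)| + |E(K_N)|, the number of pairs i ≤ j < N.
  Tr : ℕ → ℕ
  Tr zero = 0
  Tr (suc n) = Tr n + suc n

  pairsCount : ∀ N → R N (λ i → R N (λ j → sel (does (i ≤? j)) 1)) ≡ Tr N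
  pairsCount zero = refl
  pairsCount (suc N) = begin
    R (suc N) (λ i → R (suc N) (λ j → sel (does (i ≤? j)) 1))
      ≡⟨ R-ext (suc N) (λ i _ → R-top N (λ j → sel (does (i ≤? j)) 1)) ⟩
    R (suc N) (λ i → R N (λ j → sel (does (i ≤? j)) 1) + sel (does (i ≤? N)) 1)
      ≡⟨ R-top N _ ⟩
    R N (λ i → R N (λ j → sel (does (i ≤? j)) 1) + sel (does (i ≤? N)) 1) + (R N (λ j → sel (does (N ≤? j)) 1) + sel (does (N ≤? N)) 1)
      ≡⟨ cong₂ _+_ (trans (R-+ N _ _) (cong₂ _+_ (pairsCount N) lastColumn)) (cong₂ _+_ lastRow (sel-yes (N ≤? N) 1 ≤-refl)) ⟩
    Tr N + N + 1
      ≡⟨ trans (+-assoc (Tr N) N 1) (cong (Tr N +_) (+-comm N 1)) ⟩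
    Tr N + suc N ∎
    where
    open ≡-Reasoning
    lastColumn : R N (λ i → sel (does (i ≤? N)) 1) ≡ N
    lastColumn = trans (R-ext N (λ i i<N → sel-yes (i ≤? N) 1 (<⇒≤ i<N))) (trans (R-const N 1) (*-identityʳ N))
    lastRow : R N (λ j → sel (does (N ≤? j)) 1) ≡ 0
    lastRow = trans (R-ext N (λ j j<N → sel-no (N ≤? j) 1 (<⇒≱ j<N))) (R-zero N)

module Parameters where

  open import Data.Nat
  open import Data.Nat.Properties
  open import Data.Nat.Tactic.RingSolver
  open import Data.Product using (Σ; _×_; _,_; proj₁; proj₂)
  open import Data.Empty using (⊥; ⊥-elim)
  open import Relation.Nullary using (yes; no)
  open import Relation.Binary.PropositionalEquality
  open Colourings using (Tr)

  -- F t = #{(i , j) : i ≤ j, i + j < t}: the number of matrix cells of the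
  -- upper triangle strictly above the anti-diagonal i + j = t.  The anti-diagonal
  -- i + j = s contributes ⌊s/2⌋ + 1 cells with i ≤ j.
  F : ℕ → ℕ
  F zero = 0
  F (suc zero) = 1
  F (suc (suc t)) = F t + t + 2

  F-step : ∀ t → F (suc t) ≡ F t + (⌊ t /2⌋ + 1)
  F-step zero = refl
  F-step (suc zero) = refl
  F-step (suc (suc t)) = trans (cong (λ z → z + suc t + 2) (F-step t)) (lem (F t) t ⌊ t /2⌋)
    where
    lem : ∀ a t h → a + (h + 1) + (1 + t) + 2 ≡ a + t + 2 + (suc h + 1)
    lem = solve-∀

  F-up : ∀ t → 4 * F t ≤ (t + 1) * (t + 1)
  F-up zero = z≤n
  F-up (suc zero) = ≤-refl
  F-up (suc (suc t)) = begin
    4 * (F t + t + 2)               ≡⟨ l1 (F t) t ⟩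
    4 * F t + (4 * t + 8)           ≤⟨ +-monoˡ-≤ (4 * t + 8) (F-up t) ⟩
    (t + 1) * (t + 1) + (4 * t + 8) ≡⟨ l2 t ⟩
    (suc (suc t) + 1) * (suc (suc t) + 1) ∎
    where
    open ≤-Reasoning
    l1 : ∀ a t → 4 * (a + t + 2) ≡ 4 * a + (4 * t + 8)
    l1 = solve-∀
    l2 : ∀ t → (t + 1) * (t + 1) + (4 * t + 8) ≡ (2 + t + 1) * (2 + t + 1)
    l2 = solve-∀

  F-lo : ∀ t → t * (t + 2) ≤ 4 * F t
  F-lo zero = z≤n
  F-lo (suc zero) = s≤s (s≤s (s≤s z≤n))
  F-lo (suc (suc t)) = begin
    (2 + t) * (2 + t + 2)       ≡⟨ l2 t ⟩
    t * (t + 2) + (4 * t + 8)   ≤⟨ +-monoˡ-≤ (4 * t + 8) (F-lo t) ⟩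
    4 * F t + (4 * t + 8)       ≡⟨ sym (l1 (F t) t) ⟩
    4 * (F t + t + 2)           ∎
    where
    open ≤-Reasoning
    l1 : ∀ a t → 4 * (a + t + 2) ≡ 4 * a + (4 * t + 8)
    l1 = solve-∀
    l2 : ∀ t → (2 + t) * (2 + t + 2) ≡ t * (t + 2) + (4 * t + 8)
    l2 = solve-∀

  F-mono1 : ∀ t → F t < F (suc t)
  F-mono1 t = subst (F t <_) (sym (F-step t)) (m<m+n (F t) (subst (0 <_) (+-comm 1 ⌊ t /2⌋) z<s))

  F-mono : ∀ {a b} → a ≤ b → F a ≤ F b
  F-mono {a} {b} a≤b with m≤n⇒∃[o]m+o≡n a≤b
  ... | o , refl = go a o
    where
    go : ∀ a o → F a ≤ F (a + o)
    go a zero = ≤-reflexive (cong F (sym (+-identityʳ a)))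
    go a (suc o) = ≤-trans (go a o) (≤-trans (<⇒≤ (F-mono1 (a + o))) (≤-reflexive (cong F (sym (+-suc a o)))))

  staircaseGap : ∀ τ → Σ ℕ λ t → F t ≤ τ × τ < F (suc t)
  staircaseGap zero = 0 , z≤n , s≤s z≤n
  staircaseGap (suc τ) with staircaseGap τ
  ... | t , Ft≤τ , τ<Ft' with suc τ <? F (suc t)
  ...   | yes τ'<Ft' = t , ≤-trans Ft≤τ (n≤1+n τ) , τ'<Ft'
  ...   | no τ'≮Ft' = suc t , ≤-reflexive Ft'≡τ' , subst (_< F (suc (suc t))) Ft'≡τ' (F-mono1 (suc t))
    where
    Ft'≡τ' : F (suc t) ≡ suc τ
    Ft'≡τ' = ≤-antisym (≮⇒≥ τ'≮Ft') τ<Ft'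

  Tr2 : ∀ n → Tr n * 2 ≡ n * suc n
  Tr2 zero = refl
  Tr2 (suc n) = trans (*-distribʳ-+ 2 (Tr n) (suc n)) (trans (cong (_+ suc n * 2) (Tr2 n)) (lem n))
    where
    lem : ∀ n → n * suc n + suc n * 2 ≡ suc n * suc (suc n)
    lem = solve-∀

  Tr-mod3 : ∀ n → Σ ℕ λ τ → Σ ℕ λ δ → δ ≤ 1 × Tr n ≡ 3 * τ + δ
  Tr-mod3 zero = 0 , 0 , z≤n , refl
  Tr-mod3 (suc zero) = 0 , 1 , s≤s z≤n , refl
  Tr-mod3 (suc (suc zero)) = 1 , 0 , z≤n , refl
  Tr-mod3 (suc (suc (suc n))) with Tr-mod3 n
  ... | τ , δ , δ≤1 , e = τ + (n + 2) , δ , δ≤1 , trans (cong (λ z → z + suc n + suc (suc n) + suc (suc (suc n))) e) (lem τ δ n)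
    where
    lem : ∀ τ δ n → 3 * τ + δ + suc n + suc (suc n) + suc (suc (suc n)) ≡ 3 * (τ + (n + 2)) + δ
    lem = solve-∀

  twoHalf : ∀ t → 2 * ⌊ t /2⌋ ≤ t
  twoHalf t = ≤-trans (≤-reflexive (cong (⌊ t /2⌋ +_) (+-identityʳ _)))
    (≤-trans (+-monoʳ-≤ ⌊ t /2⌋ (⌊n/2⌋≤⌈n/2⌉ t)) (≤-reflexive (⌊n/2⌋+⌈n/2⌉≡n t)))

  -- The three size estimates below say that the staircase with F t ≈ N(N+1)/6
  -- cells fits into the N × N matrix with room to spare (they fail for small N).

  -- If t ≥ N - 1 then F t would exceed a third of the N(N+1)/2 cells (N ≥ 4).
  staircaseFits : ∀ N t τ → 4 ≤ N → N ≤ suc t → F t ≤ τ → 6 * τ ≤ N * suc N → ⊥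
  staircaseFits (suc n) t τ (s≤s n≥3) (s≤s n≤t) Ft≤τ h6 = m+1+n≰m (2 * n + 2) (≤-trans (≤-reflexive (l n n≥3)) 3n≤2n+2)
    where
    open ≤-Reasoning
    lower : n * (n + 2) ≤ 4 * τ
    lower = ≤-trans (F-lo n) (*-monoʳ-≤ 4 (≤-trans (F-mono n≤t) Ft≤τ))
    squeeze : (3 * n) * (n + 2) ≤ (2 * n + 2) * (n + 2)
    squeeze = begin
      (3 * n) * (n + 2)           ≡⟨ l1 n ⟩
      3 * (n * (n + 2))           ≤⟨ *-monoʳ-≤ 3 lower ⟩
      3 * (4 * τ)                 ≡⟨ l2 τ ⟩
      2 * (6 * τ)                 ≤⟨ *-monoʳ-≤ 2 h6 ⟩
      2 * (suc n * suc (suc n))   ≡⟨ l3 n ⟩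
      (2 * n + 2) * (n + 2)       ∎
      where
      l1 : ∀ n → (3 * n) * (n + 2) ≡ 3 * (n * (n + 2))
      l1 = solve-∀
      l2 : ∀ τ → 3 * (4 * τ) ≡ 2 * (6 * τ)
      l2 = solve-∀
      l3 : ∀ n → 2 * ((1 + n) * (1 + (1 + n))) ≡ (2 * n + 2) * (n + 2)
      l3 = solve-∀
    3n≤2n+2 : 3 * n ≤ 2 * n + 2
    3n≤2n+2 = *-cancelʳ-≤ (3 * n) (2 * n + 2) (n + 2) {{subst NonZero (+-comm 2 n) _}} squeeze
    l : ∀ n → 3 ≤ n → 2 * n + 2 + suc (n ∸ 3) ≡ 3 * n
    l n h with m≤n⇒∃[o]m+o≡n h
    ... | o , refl = trans (cong (λ z → 2 * (3 + o) + 2 + suc z) (m+n∸m≡n 3 o)) (l' o)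
      where
      l' : ∀ o → 2 * (3 + o) + 2 + suc o ≡ 3 * (3 + o)
      l' = solve-∀

  -- If 3t + 6 ≤ 2N then even F (t+1) is below a third of the cells.
  staircaseReachesCorner : ∀ N t τ → 3 * t + 6 ≤ 2 * N → τ < F (suc t) → N * suc N ≤ 6 * τ + 2 → ⊥
  staircaseReachesCorner N t τ h τ< hN = m+1+n≰m (4 * (N * N)) chain
    where
    open ≤-Reasoning
    chain : 4 * (N * N) + suc (2 * (N * N) + 6 * N + 23) ≤ 4 * (N * N)
    chain = begin
      4 * (N * N) + suc (2 * (N * N) + 6 * N + 23) ≡⟨ l1 N ⟩
      6 * (N * suc N) + 24                        ≤⟨ +-monoˡ-≤ 24 (*-monoʳ-≤ 6 hN) ⟩
      6 * (6 * τ + 2) + 24                        ≡⟨ l2 τ ⟩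
      9 * (4 * suc τ)                             ≤⟨ *-monoʳ-≤ 9 (*-monoʳ-≤ 4 τ<) ⟩
      9 * (4 * F (suc t))                         ≤⟨ *-monoʳ-≤ 9 (F-up (suc t)) ⟩
      9 * ((suc t + 1) * (suc t + 1))             ≡⟨ l3 t ⟩
      (3 * t + 6) * (3 * t + 6)                   ≤⟨ *-mono-≤ h h ⟩
      (2 * N) * (2 * N)                           ≡⟨ l4 N ⟩
      4 * (N * N)                                 ∎
      where
      l1 : ∀ N → 4 * (N * N) + suc (2 * (N * N) + 6 * N + 23) ≡ 6 * (N * suc N) + 24
      l1 = solve-∀
      l2 : ∀ τ → 6 * (6 * τ + 2) + 24 ≡ 9 * (4 * suc τ)
      l2 = solve-∀
      l3 : ∀ t → 9 * ((suc t + 1) * (suc t + 1)) ≡ (3 * t + 6) * (3 * t + 6)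
      l3 = solve-∀
      l4 : ∀ N → (2 * N) * (2 * N) ≡ 4 * (N * N)
      l4 = solve-∀

  -- If 4t + 6 ≤ 3N, the cells of the staircase plus t/3 further ones cannot make
  -- up a third of all cells.
  staircaseTooSmall : ∀ N t → 4 * t + 6 ≤ 3 * N → 2 * (N * suc N) ≤ 3 * ((t + 1) * (t + 1)) + 4 * t + 4 → ⊥
  staircaseTooSmall N t h hN = m+1+n≰m (27 * (t * t) + 90 * t + 63) chain
    where
    open ≤-Reasoning
    chain : 27 * (t * t) + 90 * t + 63 + suc (5 * (t * t) + 30 * t + 44) ≤ 27 * (t * t) + 90 * t + 63
    chain = begin
      27 * (t * t) + 90 * t + 63 + suc (5 * (t * t) + 30 * t + 44) ≡⟨ l1 t ⟩
      2 * ((4 * t + 6) * (4 * t + 6 + 3))        ≤⟨ *-monoʳ-≤ 2 (*-mono-≤ h (+-monoˡ-≤ 3 h)) ⟩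
      2 * ((3 * N) * (3 * N + 3))                ≡⟨ l2 N ⟩
      9 * (2 * (N * suc N))                      ≤⟨ *-monoʳ-≤ 9 hN ⟩
      9 * (3 * ((t + 1) * (t + 1)) + 4 * t + 4)  ≡⟨ l3 t ⟩
      27 * (t * t) + 90 * t + 63                 ∎
      where
      l1 : ∀ t → 27 * (t * t) + 90 * t + 63 + suc (5 * (t * t) + 30 * t + 44) ≡ 2 * ((4 * t + 6) * (4 * t + 6 + 3))
      l1 = solve-∀
      l2 : ∀ N → 2 * ((3 * N) * (3 * N + 3)) ≡ 9 * (2 * (N * suc N))
      l2 = solve-∀
      l3 : ∀ t → 9 * (3 * ((t + 1) * (t + 1)) + 4 * t + 4) ≡ 27 * (t * t) + 90 * t + 63
      l3 = solve-∀

  halfAntiDiagonal : ∀ t p → F t + p < F (suc t) → 2 * p ≤ t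
  halfAntiDiagonal t p lt = ≤-trans (*-monoʳ-≤ 2 p≤h) (twoHalf t)
    where
    p≤h : p ≤ ⌊ t /2⌋
    p≤h = ≤-pred (subst (p <_) (+-comm ⌊ t /2⌋ 1) (+-cancelˡ-< (F t) p (⌊ t /2⌋ + 1) (subst (F t + p <_) (F-step t) lt)))

  roomBelow : ∀ N t τ → 5 ≤ N → F t ≤ τ → 6 * τ ≤ N * suc N → t + 2 ≤ N
  roomBelow N t τ N≥5 Ft≤τ 6τ≤ with t + 2 ≤? N
  ... | yes h = h
  ... | no h = ⊥-elim (staircaseFits N t τ (≤-trans (n≤1+n 4) N≥5) (≤-pred (subst (N <_) (+-comm t 2) (≰⇒> h))) Ft≤τ 6τ≤)

  -- The staircase and its mirror image are separated: N + p ≤ 2t + 2.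
  roomBetween : ∀ N t p → F t + p < F (suc t) → 2 * p ≤ t → N * suc N ≤ 6 * (F t + p) + 2 → N + p ≤ 2 * t + 2
  roomBetween N t p lt hp hN with N + p ≤? 2 * t + 2
  ... | yes h = h
  ... | no h = ⊥-elim (staircaseReachesCorner N t (F t + p) h3 lt hN)
    where
    open ≤-Reasoning
    h' : 2 * t + 3 ≤ N + p
    h' = subst (_≤ N + p) (trans (+-comm 1 (2 * t + 2)) (+-assoc (2 * t) 2 1)) (≰⇒> h)
    h3 : 3 * t + 6 ≤ 2 * N
    h3 = +-cancelʳ-≤ t (3 * t + 6) (2 * N) (begin
      3 * t + 6 + t       ≡⟨ l t ⟩
      2 * (2 * t + 3)     ≤⟨ *-monoʳ-≤ 2 h' ⟩
      2 * (N + p)         ≡⟨ *-distribˡ-+ 2 N p ⟩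
      2 * N + 2 * p       ≤⟨ +-monoʳ-≤ (2 * N) hp ⟩
      2 * N + t           ∎)
      where
      l : ∀ t → 3 * t + 6 + t ≡ 2 * (2 * t + 3)
      l = solve-∀

  -- When the two anti-diagonals are adjacent (N + 2p = 2t + 2), the filling has
  -- more than t/3 pairs ...
  glitchManyPairs : ∀ N t p → N * suc N ≤ 6 * (F t + p) + 2 → N + 2 * p ≡ 2 * t + 2 → t < 3 * p
  glitchManyPairs N t p hN6 e with t <? 3 * p
  ... | yes h = h
  ... | no h = ⊥-elim (staircaseTooSmall N t h4 hN)
    where
    open ≤-Reasoning
    3p≤t : 3 * p ≤ t
    3p≤t = ≮⇒≥ h
    h4 : 4 * t + 6 ≤ 3 * N
    h4 = +-cancelʳ-≤ (2 * t) (4 * t + 6) (3 * N) (begin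
      4 * t + 6 + 2 * t       ≡⟨ l1 t ⟩
      3 * (2 * t + 2)         ≡⟨ cong (3 *_) (sym e) ⟩
      3 * (N + 2 * p)         ≡⟨ l2 N p ⟩
      3 * N + 2 * (3 * p)     ≤⟨ +-monoʳ-≤ (3 * N) (*-monoʳ-≤ 2 3p≤t) ⟩
      3 * N + 2 * t           ∎)
      where
      l1 : ∀ t → 4 * t + 6 + 2 * t ≡ 3 * (2 * t + 2)
      l1 = solve-∀
      l2 : ∀ N p → 3 * (N + 2 * p) ≡ 3 * N + 2 * (3 * p)
      l2 = solve-∀
    hN : 2 * (N * suc N) ≤ 3 * ((t + 1) * (t + 1)) + 4 * t + 4
    hN = begin
      2 * (N * suc N)                          ≤⟨ *-monoʳ-≤ 2 hN6 ⟩
      2 * (6 * (F t + p) + 2)                  ≡⟨ l (F t) p ⟩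
      3 * (4 * F t) + 4 * (3 * p) + 4          ≤⟨ +-monoˡ-≤ 4 (+-mono-≤ (*-monoʳ-≤ 3 (F-up t)) (*-monoʳ-≤ 4 3p≤t)) ⟩
      3 * ((t + 1) * (t + 1)) + 4 * t + 4      ∎
      where
      l : ∀ a p → 2 * (6 * (a + p) + 2) ≡ 3 * (4 * a) + 4 * (3 * p) + 4
      l = solve-∀

  -- ... and at least two of them.
  glitchTwoPairs : ∀ N t p → 5 ≤ N → N + 2 * p ≡ 2 * t + 2 → t < 3 * p → 2 ≤ p
  glitchTwoPairs N t p N≥5 e t<3p with 2 ≤? p
  ... | yes h = h
  ... | no h = ⊥-elim (<-irrefl refl (≤-trans (≤-trans (+-monoʳ-≤ 1 p+2≤t) t<3p) (small p (≤-pred (≰⇒> h)))))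
    where
    small : ∀ p → p ≤ 1 → 3 * p ≤ p + 2
    small zero _ = z≤n
    small (suc zero) _ = s≤s (s≤s (s≤s z≤n))
    small (suc (suc p)) (s≤s ())
    -- t ≤ p + 1 is impossible since then 2t + 2 = N + 2p ≥ 2p + 5
    p+2≤t : p + 2 ≤ t
    p+2≤t with p + 2 ≤? t
    ... | yes h = h
    ... | no h = ⊥-elim (<-irrefl refl (≤-<-trans c1 c2))
      where
      c1 : 2 * p + 5 ≤ 2 * t + 2
      c1 = ≤-trans (≤-reflexive (+-comm (2 * p) 5)) (≤-trans (+-monoˡ-≤ (2 * p) N≥5) (≤-reflexive e))
      c2 : 2 * t + 2 < 2 * p + 5
      c2 = ≤-trans (≤-reflexive (l' t)) (≤-trans (+-monoˡ-≤ 3 (*-monoʳ-≤ 2 (≤-pred (subst (t <_) (l'' p) (≰⇒> h))))) (≤-reflexive (l p)))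
        where
        l : ∀ p → 2 * (p + 1) + 3 ≡ 2 * p + 5
        l = solve-∀
        l' : ∀ t → suc (2 * t + 2) ≡ 2 * t + 3
        l' = solve-∀
        l'' : ∀ p → p + 2 ≡ suc (p + 1)
        l'' = solve-∀

  -- With τ = ⌊Tr N / 3⌋ split as F t + p,
  -- colour 1 will occupy the staircase i + j < t plus p cells of the
  -- anti-diagonal i + j = t, colour 3 the mirror image, colour 2 the rest.
  record Params (N : ℕ) : Set where
    field
      t p δ : ℕ
      δ≤1 : δ ≤ 1
      eqT : Tr N ≡ 3 * (F t + p) + δ
      hp : 2 * p ≤ t
      ht : t + 2 ≤ N
      ha : N + p ≤ 2 * t + 2
      -- in the glitch case the modified filling SU p is available
      hg : N + 2 * p ≡ 2 * t + 2 → t < 3 * p × 2 ≤ p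

  params : ∀ N → 5 ≤ N → Params N
  params N N≥5 = record
    { t = t ; p = p ; δ = δ ; δ≤1 = δ≤1 ; eqT = eqT ; hp = hp
    ; ht = roomBelow N t τ N≥5 Ft≤τ 6τ≤
    ; ha = roomBetween N t p Ftp<Ft' hp ≤6X+2
    ; hg = λ g → glitchManyPairs N t p ≤6X+2 g , glitchTwoPairs N t p N≥5 g (glitchManyPairs N t p ≤6X+2 g) }
    where
    open ≤-Reasoning
    τ δ : ℕ
    τ = proj₁ (Tr-mod3 N)
    δ = proj₁ (proj₂ (Tr-mod3 N))
    δ≤1 : δ ≤ 1
    δ≤1 = proj₁ (proj₂ (proj₂ (Tr-mod3 N)))
    eTr : Tr N ≡ 3 * τ + δ
    eTr = proj₂ (proj₂ (proj₂ (Tr-mod3 N)))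
    t : ℕ
    t = proj₁ (staircaseGap τ)
    Ft≤τ : F t ≤ τ
    Ft≤τ = proj₁ (proj₂ (staircaseGap τ))
    p : ℕ
    p = τ ∸ F t
    Ftp≡τ : F t + p ≡ τ
    Ftp≡τ = m+[n∸m]≡n Ft≤τ
    Ftp<Ft' : F t + p < F (suc t)
    Ftp<Ft' = subst (_< F (suc t)) (sym Ftp≡τ) (proj₂ (proj₂ (staircaseGap τ)))
    eqT : Tr N ≡ 3 * (F t + p) + δ
    eqT = trans eTr (cong (λ z → 3 * z + δ) (sym Ftp≡τ))
    hp : 2 * p ≤ t
    hp = halfAntiDiagonal t p Ftp<Ft'
    6τ≤ : 6 * τ ≤ N * suc N
    6τ≤ = ≤-trans (≤-reflexive (l τ)) (≤-trans (*-monoˡ-≤ 2 (≤-trans (m≤m+n (3 * τ) δ) (≤-reflexive (sym eTr)))) (≤-reflexive (Tr2 N)))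
      where
      l : ∀ τ → 6 * τ ≡ 3 * τ * 2
      l = solve-∀
    ≤6X+2 : N * suc N ≤ 6 * (F t + p) + 2
    ≤6X+2 = begin
      N * suc N                 ≡⟨ sym (Tr2 N) ⟩
      Tr N * 2                  ≡⟨ cong (_* 2) eqT ⟩
      (3 * (F t + p) + δ) * 2   ≤⟨ *-monoˡ-≤ 2 (+-monoʳ-≤ (3 * (F t + p)) δ≤1) ⟩
      (3 * (F t + p) + 1) * 2   ≡⟨ l (F t + p) ⟩
      6 * (F t + p) + 2         ∎
      where
      l : ∀ τ → (3 * τ + 1) * 2 ≡ 6 * τ + 2
      l = solve-∀

module Staircase where

  open import Data.Nat
  open import Data.Nat.Properties
  open import Data.Bool using (Bool; true; false; _∨_; _∧_)
  open import Data.Product using (_×_; _,_; proj₁; proj₂)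
  open import Data.Sum using (_⊎_; inj₁; inj₂)
  open import Data.Empty using (⊥-elim)
  open import Relation.Nullary using (Dec; yes; no; does; ¬_)
  open import Relation.Binary.PropositionalEquality
  open import Relation.Binary using (tri<; tri≈; tri>)
  open Summation

  dtrue : ∀ {A : Set} (d : Dec A) → does d ≡ true → A
  dtrue (yes a) _ = a
  dtrue (no _) ()

  dfalse : ∀ {A : Set} (d : Dec A) → does d ≡ false → ¬ A
  dfalse (yes _) ()
  dfalse (no na) _ = na

  ∨true : ∀ {A B : Set} (d1 : Dec A) (d2 : Dec B) → does d1 ∨ does d2 ≡ true → A ⊎ B
  ∨true (yes a) d2 _ = inj₁ a
  ∨true (no _) (yes b) _ = inj₂ b
  ∨true (no _) (no _) ()

  ∨false : ∀ {A B : Set} (d1 : Dec A) (d2 : Dec B) → does d1 ∨ does d2 ≡ false → ¬ A × ¬ B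
  ∨false (yes _) d2 ()
  ∨false (no na) (yes _) ()
  ∨false (no na) (no nb) _ = na , nb

  -- For a threshold t and a filling
  -- 'fill' of the anti-diagonal, Stair N t fill is the symmetric set of cells
  -- (u , v) of the N × N matrix with u + v < t, together with those cells on the
  -- anti-diagonal u + v = t whose smaller coordinate k = u ⊓ v has fill k = true.
  -- Λ w counts the cells of column w in the region: since the region is a
  -- staircase, Λ w = (t - w) + [cell (t - w , w) is filled].

  columnSplit : ∀ {A1 A2 B1 B2 C : Set} (d1 : Dec A1) (d2 : Dec A2) (d3 : Dec B1) (d4 : Dec B2) (d5 : Dec C) (s : Bool) →
    (A1 → B1) → (B1 → A1) → (A2 → B2 × C) → (B2 → C → A2) → (B1 → ¬ B2) →
    b2n (does d1 ∨ (does d2 ∧ s)) ≡ b2n (does d3) + sel (does d4) (sel (does d5) (b2n s))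
  columnSplit (yes a1) d2 (yes b1) (yes b2) d5 s f1 g1 f2 g2 dis = ⊥-elim (dis b1 b2)
  columnSplit (yes a1) d2 (yes b1) (no _) d5 s f1 g1 f2 g2 dis = refl
  columnSplit (yes a1) d2 (no nb1) d4 d5 s f1 g1 f2 g2 dis = ⊥-elim (nb1 (f1 a1))
  columnSplit (no na1) d2 (yes b1) d4 d5 s f1 g1 f2 g2 dis = ⊥-elim (na1 (g1 b1))
  columnSplit (no na1) (yes a2) (no _) (yes _) (yes _) s f1 g1 f2 g2 dis = refl
  columnSplit (no na1) (yes a2) (no _) (no nb2) d5 s f1 g1 f2 g2 dis = ⊥-elim (nb2 (proj₁ (f2 a2)))
  columnSplit (no na1) (yes a2) (no _) (yes _) (no nc) s f1 g1 f2 g2 dis = ⊥-elim (nc (proj₂ (f2 a2)))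
  columnSplit (no na1) (no na2) (no _) (yes b2) (yes c) s f1 g1 f2 g2 dis = ⊥-elim (na2 (g2 b2 c))
  columnSplit (no na1) (no na2) (no _) (yes b2) (no _) s f1 g1 f2 g2 dis = refl
  columnSplit (no na1) (no na2) (no _) (no _) d5 s f1 g1 f2 g2 dis = refl

  module Stair (N t : ℕ) (fill : ℕ → Bool) where

    inX : ℕ → ℕ → Bool
    inX u v = does (u + v <? t) ∨ (does (u + v ≟ t) ∧ fill (u ⊓ v))

    Λ : ℕ → ℕ
    Λ w = R N (λ u → b2n (inX u w))

    ε : ℕ → ℕ
    ε w = sel (does (w ≤? t)) (b2n (fill ((t ∸ w) ⊓ w)))

    inX-column : ∀ u w → b2n (inX u w) ≡ b2n (does (u <? t ∸ w)) + sel (does (u ≟ t ∸ w)) (sel (does (w ≤? t)) (b2n (fill (u ⊓ w))))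
    inX-column u w = columnSplit (u + w <? t) (u + w ≟ t) (u <? t ∸ w) (u ≟ t ∸ w) (w ≤? t) (fill (u ⊓ w))
      (λ h → m+n≤o⇒m≤o∸n (suc u) h)
      (λ h → m≤o∸n⇒m+n≤o (suc u) (w≤t' h) h)
      (λ h → trans (sym (m+n∸n≡m u w)) (cong (_∸ w) h) , subst (w ≤_) h (m≤n+m w u))
      (λ h w≤t → trans (cong (_+ w) h) (m∸n+n≡m w≤t))
      (λ h e → <-irrefl e h)
      where
      w≤t' : suc u ≤ t ∸ w → w ≤ t
      w≤t' h with w ≤? t
      ... | yes w≤t = w≤t
      ... | no w≰t with subst (suc u ≤_) (m≤n⇒m∸n≡0 (<⇒≤ (≰⇒> w≰t))) h
      ...   | ()

    Λ-closed : t < N → ∀ w → Λ w ≡ (t ∸ w) + ε w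
    Λ-closed t<N w = begin
      Λ w ≡⟨ R-ext N (λ u _ → inX-column u w) ⟩
      R N (λ u → b2n (does (u <? t ∸ w)) + sel (does (u ≟ t ∸ w)) (sel (does (w ≤? t)) (b2n (fill (u ⊓ w))))) ≡⟨ R-+ N _ _ ⟩
      R N (λ u → b2n (does (u <? t ∸ w))) + R N (λ u → sel (does (u ≟ t ∸ w)) (sel (does (w ≤? t)) (b2n (fill (u ⊓ w)))))
        ≡⟨ cong₂ _+_ (R-lt N (t ∸ w) (≤-trans (m∸n≤m t w) (<⇒≤ t<N))) (R-δ N (t ∸ w) (λ u → sel (does (w ≤? t)) (b2n (fill (u ⊓ w)))) (≤-<-trans (m∸n≤m t w) t<N)) ⟩
      (t ∸ w) + ε w ∎
      where open ≡-Reasoning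

    inX-sym : ∀ u v → inX u v ≡ inX v u
    inX-sym u v = cong₂ (λ a b → does (a <? t) ∨ (does (a ≟ t) ∧ fill b)) (+-comm u v) (⊓-comm u v)

    inX-le : ∀ u v → inX u v ≡ true → u + v ≤ t
    inX-le u v h with ∨-split (u + v <? t) (does (u + v ≟ t) ∧ fill (u ⊓ v)) h
      where
      ∨-split : ∀ {A : Set} (d : Dec A) b → does d ∨ b ≡ true → A ⊎ b ≡ true
      ∨-split (yes a) b _ = inj₁ a
      ∨-split (no _) b e = inj₂ e
    ... | inj₁ lt = <⇒≤ lt
    ... | inj₂ e = ≤-reflexive (∧-split (u + v ≟ t) (fill (u ⊓ v)) e)
      where
      ∧-split : ∀ {A : Set} (d : Dec A) b → does d ∧ b ≡ true → A
      ∧-split (yes a) b _ = a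
      ∧-split (no _) b ()

    Λc : ℕ → ℕ
    Λc w = (t ∸ w) + ε w

    ∸suc : ∀ w → w < t → t ∸ w ≡ suc (t ∸ suc w)
    ∸suc w w<t = +-∸-assoc 1 {t} {suc w} w<t

    ε-big : ∀ w → t < w → ε w ≡ 0
    ε-big w t<w = sel-no (w ≤? t) _ (<⇒≱ t<w)

    Λc-mono : ∀ w → Λc (suc w) ≤ Λc w
    Λc-mono w with w <? t
    ... | yes w<t = begin
        (t ∸ suc w) + ε (suc w) ≤⟨ +-monoʳ-≤ (t ∸ suc w) (≤-trans (sel-≤ (does (suc w ≤? t)) (b2n (fill ((t ∸ suc w) ⊓ suc w)))) (b2n≤1 _)) ⟩
        (t ∸ suc w) + 1 ≡⟨ +-comm (t ∸ suc w) 1 ⟩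
        suc (t ∸ suc w) ≡⟨ sym (∸suc w w<t) ⟩
        t ∸ w ≤⟨ m≤m+n (t ∸ w) (ε w) ⟩
        (t ∸ w) + ε w ∎
      where open ≤-Reasoning
    ... | no w≮t = ≤-trans (≤-reflexive (cong₂ _+_ (m≤n⇒m∸n≡0 (≤-trans (≮⇒≥ w≮t) (n≤1+n w))) (ε-big (suc w) (s≤s (≮⇒≥ w≮t))))) z≤n

    -- ... and strictly decrease at w < t unless the filling of the
    -- anti-diagonal gains a cell when passing from column w to column w + 1
    Λc-strict : ∀ w → w < t → (fill ((t ∸ suc w) ⊓ suc w) ≡ true → fill (suc (t ∸ suc w) ⊓ w) ≡ true) → Λc (suc w) < Λc w
    Λc-strict w w<t imp = begin-strict
        (t ∸ suc w) + ε (suc w) ≡⟨ cong ((t ∸ suc w) +_) (sel-yes (suc w ≤? t) _ w<t) ⟩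
        (t ∸ suc w) + b2n (fill ((t ∸ suc w) ⊓ suc w)) ≤⟨ +-monoʳ-≤ (t ∸ suc w) (b2n-mono _ _ imp) ⟩
        (t ∸ suc w) + b2n (fill (suc (t ∸ suc w) ⊓ w)) <⟨ ≤-refl ⟩
        suc (t ∸ suc w) + b2n (fill (suc (t ∸ suc w) ⊓ w)) ≡⟨ cong₂ (λ a b → a + b2n (fill (b ⊓ w))) (sym e) (sym e) ⟩
        (t ∸ w) + b2n (fill ((t ∸ w) ⊓ w)) ≡⟨ cong ((t ∸ w) +_) (sym (sel-yes (w ≤? t) _ (<⇒≤ w<t))) ⟩
        (t ∸ w) + ε w ∎
      where
      open ≤-Reasoning
      e = ∸suc w w<t
      b2n-mono : ∀ a b → (a ≡ true → b ≡ true) → b2n a ≤ b2n b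
      b2n-mono false b _ = z≤n
      b2n-mono true b f with f refl
      ... | refl = ≤-refl

    -- column t holds exactly the corner cell (0 , t) iff fill 0, column t + 1 nothing
    Λc-strict-at-t : fill 0 ≡ true → Λc (suc t) < Λc t
    Λc-strict-at-t s0 = subst₂ _<_ (sym e1) (sym e2) (s≤s z≤n)
      where
      e1 : Λc (suc t) ≡ 0
      e1 = cong₂ _+_ (m≤n⇒m∸n≡0 (n≤1+n t)) (ε-big (suc t) ≤-refl)
      e2 : Λc t ≡ 1
      e2 = trans (cong₂ _+_ (n∸n≡0 t) (sel-yes (t ≤? t) _ ≤-refl)) (trans (cong (λ z → b2n (fill (z ⊓ t))) (n∸n≡0 t)) (cong b2n s0))

  -- The two anti-diagonal fillings: SD p takes the first p symmetric pairs
  -- k = 0, …, p-1; SU p takes k = 0, …, p-2 and k = p, which is needed when the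
  -- two staircases of the construction would otherwise collide.
  SD : ℕ → ℕ → Bool
  SD p k = does (k <? p)

  SU : ℕ → ℕ → Bool
  SU p k = does (k <? p ∸ 1) ∨ does (k ≟ p)

  glitchD : ∀ p x w → SD p (x ⊓ suc w) ≡ true → SD p (suc x ⊓ w) ≡ false → suc x ≡ p
  glitchD p x w h1 h2 = go (≤-total x (suc w))
    where
    a : x ⊓ suc w < p
    a = dtrue (x ⊓ suc w <? p) h1
    b : p ≤ suc x ⊓ w
    b = ≮⇒≥ (dfalse (suc x ⊓ w <? p) h2)
    p≤sx : p ≤ suc x
    p≤sx = ≤-trans b (m⊓n≤m (suc x) w)
    p≤w : p ≤ w
    p≤w = ≤-trans b (m⊓n≤n (suc x) w)
    go : x ≤ suc w ⊎ suc w ≤ x → suc x ≡ p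
    go (inj₁ x≤sw) = ≤-antisym (subst (_< p) (m≤n⇒m⊓n≡m x≤sw) a) p≤sx
    go (inj₂ sw≤x) = ⊥-elim (<-irrefl refl (≤-trans (subst (_< p) (m≥n⇒m⊓n≡n sw≤x) a) (≤-trans p≤w (n≤1+n w))))

  glitchU : ∀ p x w → SU p (x ⊓ suc w) ≡ true → SU p (suc x ⊓ w) ≡ false → suc w ≡ p ⊎ x ≡ p ⊎ x + 2 ≡ p
  glitchU p x w h1 h2 with <-cmp x w
  ... | tri≈ _ refl _ = ⊥-elim (¬a' (subst (λ z → z < p ∸ 1 ⊎ z ≡ p) (trans (m≤n⇒m⊓n≡m (n≤1+n x)) (sym (m≥n⇒m⊓n≡n (n≤1+n x)))) (∨true (x ⊓ suc x <? p ∸ 1) (x ⊓ suc x ≟ p) h1)))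
    where
    ¬a' : ¬ (suc x ⊓ x < p ∸ 1 ⊎ suc x ⊓ x ≡ p)
    ¬a' (inj₁ q) = proj₁ (∨false (suc x ⊓ x <? p ∸ 1) (suc x ⊓ x ≟ p) h2) q
    ¬a' (inj₂ q) = proj₂ (∨false (suc x ⊓ x <? p ∸ 1) (suc x ⊓ x ≟ p) h2) q
  ... | tri< x<w _ _ = go (subst (λ z → z < p ∸ 1 ⊎ z ≡ p) (m≤n⇒m⊓n≡m (≤-trans (<⇒≤ x<w) (n≤1+n w))) (∨true (x ⊓ suc w <? p ∸ 1) (x ⊓ suc w ≟ p) h1))
    where
    nb : ¬ (suc x ⊓ w < p ∸ 1) × ¬ (suc x ⊓ w ≡ p)
    nb = ∨false (suc x ⊓ w <? p ∸ 1) (suc x ⊓ w ≟ p) h2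
    e : suc x ⊓ w ≡ suc x
    e = m≤n⇒m⊓n≡m x<w
    b1 : p ∸ 1 ≤ suc x
    b1 = subst (p ∸ 1 ≤_) e (≮⇒≥ (proj₁ nb))
    go : x < p ∸ 1 ⊎ x ≡ p → suc w ≡ p ⊎ x ≡ p ⊎ x + 2 ≡ p
    go (inj₂ q) = inj₂ (inj₁ q)
    go (inj₁ q) = inj₂ (inj₂ (lem p (≤-antisym q b1)))
      where
      lem : ∀ p → suc x ≡ p ∸ 1 → x + 2 ≡ p
      lem zero ()
      lem (suc p) h = trans (+-comm x 2) (cong suc h)
  ... | tri> _ _ w<x = go (subst (λ z → z < p ∸ 1 ⊎ z ≡ p) (m≥n⇒m⊓n≡n w<x) (∨true (x ⊓ suc w <? p ∸ 1) (x ⊓ suc w ≟ p) h1))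
    where
    nb : ¬ (suc x ⊓ w < p ∸ 1) × ¬ (suc x ⊓ w ≡ p)
    nb = ∨false (suc x ⊓ w <? p ∸ 1) (suc x ⊓ w ≟ p) h2
    e : suc x ⊓ w ≡ w
    e = m≥n⇒m⊓n≡n (≤-trans (<⇒≤ w<x) (n≤1+n x))
    b1 : p ∸ 1 ≤ w
    b1 = subst (p ∸ 1 ≤_) e (≮⇒≥ (proj₁ nb))
    go : suc w < p ∸ 1 ⊎ suc w ≡ p → suc w ≡ p ⊎ x ≡ p ⊎ x + 2 ≡ p
    go (inj₂ q) = inj₁ q
    go (inj₁ q) = ⊥-elim (<-irrefl refl (≤-trans (≤-trans (s≤s (n≤1+n w)) q) b1))

  strictD : ∀ N t p w → w < t → w + p ≢ t → Stair.Λc N t (SD p) (suc w) < Stair.Λc N t (SD p) w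
  strictD N t p w w<t ne = Stair.Λc-strict N t (SD p) w w<t imp
    where
    x : ℕ
    x = t ∸ suc w
    imp : SD p (x ⊓ suc w) ≡ true → SD p (suc x ⊓ w) ≡ true
    imp h with SD p (suc x ⊓ w) in q
    ... | true = refl
    ... | false = ⊥-elim (ne (trans (cong (w +_) (sym (glitchD p x w h q))) (trans (+-suc w x) (m+[n∸m]≡n w<t))))

  strictU : ∀ N t p w → w < t → suc w ≢ p → suc w + p ≢ t → w + p ≢ t + 1 → Stair.Λc N t (SU p) (suc w) < Stair.Λc N t (SU p) w
  strictU N t p w w<t n1 n2 n3 = Stair.Λc-strict N t (SU p) w w<t imp
    where
    x : ℕ
    x = t ∸ suc w
    ex : suc w + x ≡ t
    ex = m+[n∸m]≡n w<t
    l : ∀ w x → w + (x + 2) ≡ suc w + x + 1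
    l w x = trans (cong (w +_) (+-comm x 2)) (trans (+-suc w (suc x)) (trans (cong suc (+-suc w x)) (+-comm 1 (suc w + x))))
    imp : SU p (x ⊓ suc w) ≡ true → SU p (suc x ⊓ w) ≡ true
    imp h with SU p (suc x ⊓ w) in q
    ... | true = refl
    ... | false with glitchU p x w h q
    ...   | inj₁ e = ⊥-elim (n1 e)
    ...   | inj₂ (inj₁ e) = ⊥-elim (n2 (trans (cong (suc w +_) (sym e)) ex))
    ...   | inj₂ (inj₂ e) = ⊥-elim (n3 (trans (cong (w +_) (sym e)) (trans (l w x) (cong (_+ 1) ex))))

module StaircaseCounting where

  open import Data.Nat
  open import Data.Nat.Properties
  open import Data.Bool using (Bool; true; false; _∨_; _∧_)
  open import Data.Product using (_×_; _,_; proj₁; proj₂)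
  open import Data.Sum using (_⊎_; inj₁; inj₂)
  open import Data.Empty using (⊥; ⊥-elim)
  open import Relation.Nullary using (Dec; yes; no; does)
  open import Relation.Binary.PropositionalEquality
  open Summation
  open Staircase
  open Parameters using (F; F-step; twoHalf)

  halfBound⇒ : ∀ i t → i + i ≤ t → i < suc ⌊ t /2⌋
  halfBound⇒ i t h = s≤s (subst (_≤ ⌊ t /2⌋) (sym (n≡⌊n+n/2⌋ i)) (⌊n/2⌋-mono h))

  halfBound⇐ : ∀ i t → i < suc ⌊ t /2⌋ → i + i ≤ t
  halfBound⇐ i t (s≤s h) = ≤-trans (+-mono-≤ h h) (≤-trans (≤-reflexive (cong (⌊ t /2⌋ +_) (sym (+-identityʳ _)))) (twoHalf t))

  R-half : ∀ N t → t < N → R N (λ i → b2n (does (i + i ≤? t))) ≡ suc ⌊ t /2⌋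
  R-half N t t<N = trans (R-ext N (λ i _ → doesEq' (i + i ≤? t) (i <? suc ⌊ t /2⌋) (halfBound⇒ i t) (halfBound⇐ i t))) (R-lt N (suc ⌊ t /2⌋) (≤-trans (s≤s (⌊n/2⌋≤n t)) t<N))
    where
    doesEq' : ∀ {A B : Set} (d1 : Dec A) (d2 : Dec B) → (A → B) → (B → A) → b2n (does d1) ≡ b2n (does d2)
    doesEq' d1 d2 f g = cong b2n (doesEq d1 d2 f g)

  selectPair : ∀ {A1 A2 B1 B2 : Set} (d1 : Dec A1) (d2 : Dec A2) (d3 : Dec B1) (d4 : Dec B2) x y →
    (A1 → A2 → B1 × B2 × x ≡ y) → (B1 → B2 → A1 × A2) →
    sel (does d1) (sel (does d2) x) ≡ sel (does d3) (sel (does d4) y)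
  selectPair (yes a1) (yes a2) (yes _) (yes _) x y f g = proj₂ (proj₂ (f a1 a2))
  selectPair (yes a1) (yes a2) (no nb) d4 x y f g = ⊥-elim (nb (proj₁ (f a1 a2)))
  selectPair (yes a1) (yes a2) (yes _) (no nb) x y f g = ⊥-elim (nb (proj₁ (proj₂ (f a1 a2))))
  selectPair (yes a1) (no na) (yes b1) (yes b2) x y f g = ⊥-elim (na (proj₂ (g b1 b2)))
  selectPair (no na) d2 (yes b1) (yes b2) x y f g = ⊥-elim (na (proj₁ (g b1 b2)))
  selectPair (yes a1) (no na) (yes b1) (no _) x y f g = refl
  selectPair (yes a1) (no na) (no _) d4 x y f g = refl
  selectPair (no na) d2 (yes b1) (no _) x y f g = refl
  selectPair (no na) d2 (no _) d4 x y f g = refl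

  diagonalRows : ∀ N t (g : ℕ → ℕ) → t < N →
    R N (λ i → R N (λ j → sel (does (i ≤? j)) (sel (does (i + j ≟ t)) (g (i ⊓ j))))) ≡ R N (λ i → sel (does (i + i ≤? t)) (g i))
  diagonalRows N t g t<N = R-ext N (λ i _ → trans (R-ext N (λ j _ → pwP i j)) (R-δ N (t ∸ i) (λ _ → sel (does (i + i ≤? t)) (g i)) (≤-<-trans (m∸n≤m t i) t<N)))
    where
    pwP : ∀ i j → sel (does (i ≤? j)) (sel (does (i + j ≟ t)) (g (i ⊓ j))) ≡ sel (does (j ≟ t ∸ i)) (sel (does (i + i ≤? t)) (g i))
    pwP i j = selectPair (i ≤? j) (i + j ≟ t) (j ≟ t ∸ i) (i + i ≤? t) (g (i ⊓ j)) (g i)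
      (λ i≤j e → trans (sym (m+n∸m≡n i j)) (cong (_∸ i) e) , subst (i + i ≤_) e (+-monoʳ-≤ i i≤j) , cong g (m≤n⇒m⊓n≡m i≤j))
      (λ e h → subst (i ≤_) (sym e) (m+n≤o⇒m≤o∸n i h) , trans (cong (i +_) e) (m+[n∸m]≡n (≤-trans (m≤m+n i i) h)))

  ltSucSplit : ∀ {x t} (d1 : Dec (x < suc t)) (d2 : Dec (x < t)) (d3 : Dec (x ≡ t)) → b2n (does d1) ≡ b2n (does d2) + sel (does d3) 1
  ltSucSplit (yes p) (yes q) (yes refl) = ⊥-elim (<-irrefl refl q)
  ltSucSplit (yes p) (yes q) (no _) = refl
  ltSucSplit (yes p) (no q) (yes _) = refl
  ltSucSplit {x} {t} (yes p) (no q) (no r) = ⊥-elim (r (≤-antisym (≤-pred p) (≮⇒≥ q)))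
  ltSucSplit (no p) (yes q) d3 = ⊥-elim (p (<-trans q (n<1+n _)))
  ltSucSplit (no p) (no q) (yes refl) = ⊥-elim (p (n<1+n _))
  ltSucSplit (no p) (no q) (no _) = refl

  stairCells : ∀ N t → t ≤ N → R N (λ i → R N (λ j → sel (does (i ≤? j)) (b2n (does (i + j <? t))))) ≡ F t
  stairCells N zero _ = trans (R-ext N (λ i _ → trans (R-ext N (λ j _ → sel-zero (does (i ≤? j)))) (R-zero N))) (R-zero N)
  stairCells N (suc t) st≤N = begin
    R N (λ i → R N (λ j → sel (does (i ≤? j)) (b2n (does (i + j <? suc t)))))
      ≡⟨ R-ext N (λ i _ → R-ext N (λ j _ → trans (cong (sel (does (i ≤? j))) (ltSucSplit (i + j <? suc t) (i + j <? t) (i + j ≟ t))) (sel-+ (does (i ≤? j)) _ _))) ⟩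
    R N (λ i → R N (λ j → sel (does (i ≤? j)) (b2n (does (i + j <? t))) + sel (does (i ≤? j)) (sel (does (i + j ≟ t)) 1)))
      ≡⟨ trans (R-ext N (λ i _ → R-+ N _ _)) (R-+ N _ _) ⟩
    R N (λ i → R N (λ j → sel (does (i ≤? j)) (b2n (does (i + j <? t))))) + R N (λ i → R N (λ j → sel (does (i ≤? j)) (sel (does (i + j ≟ t)) 1)))
      ≡⟨ cong₂ _+_ (stairCells N t (≤-trans (n≤1+n t) st≤N)) (trans (diagonalRows N t (λ _ → 1) st≤N) (R-half N t st≤N)) ⟩
    F t + suc ⌊ t /2⌋ ≡⟨ cong (F t +_) (+-comm 1 ⌊ t /2⌋) ⟩
    F t + (⌊ t /2⌋ + 1) ≡⟨ sym (F-step t) ⟩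
    F (suc t) ∎
    where open ≡-Reasoning

  stairSplit : ∀ {x t : ℕ} (d1 : Dec (x < t)) (d2 : Dec (x ≡ t)) s → b2n (does d1 ∨ (does d2 ∧ s)) ≡ b2n (does d1) + sel (does d2) (b2n s)
  stairSplit (yes p) (yes refl) s = ⊥-elim (<-irrefl refl p)
  stairSplit (yes p) (no _) s = refl
  stairSplit (no _) (yes _) true = refl
  stairSplit (no _) (yes _) false = refl
  stairSplit (no _) (no _) s = refl

  stairCount : ∀ N t (fill : ℕ → Bool) → t < N →
    R N (λ i → R N (λ j → sel (does (i ≤? j)) (b2n (Stair.inX N t fill i j)))) ≡ F t + R N (λ i → sel (does (i + i ≤? t)) (b2n (fill i)))
  stairCount N t fill t<N = begin
    R N (λ i → R N (λ j → sel (does (i ≤? j)) (b2n (Stair.inX N t fill i j))))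
      ≡⟨ R-ext N (λ i _ → R-ext N (λ j _ → trans (cong (sel (does (i ≤? j))) (stairSplit (i + j <? t) (i + j ≟ t) (fill (i ⊓ j)))) (sel-+ (does (i ≤? j)) _ _))) ⟩
    R N (λ i → R N (λ j → sel (does (i ≤? j)) (b2n (does (i + j <? t))) + sel (does (i ≤? j)) (sel (does (i + j ≟ t)) (b2n (fill (i ⊓ j))))))
      ≡⟨ trans (R-ext N (λ i _ → R-+ N _ _)) (R-+ N _ _) ⟩
    R N (λ i → R N (λ j → sel (does (i ≤? j)) (b2n (does (i + j <? t))))) + R N (λ i → R N (λ j → sel (does (i ≤? j)) (sel (does (i + j ≟ t)) (b2n (fill (i ⊓ j))))))
      ≡⟨ cong₂ _+_ (stairCells N t (<⇒≤ t<N)) (diagonalRows N t (λ k → b2n (fill k)) t<N) ⟩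
    F t + R N (λ i → sel (does (i + i ≤? t)) (b2n (fill i))) ∎
    where open ≡-Reasoning

  SDsum : ∀ N t p → 2 * p ≤ t → p ≤ N → R N (λ i → sel (does (i + i ≤? t)) (b2n (SD p i))) ≡ p
  SDsum N t p h p≤N = trans (R-ext N (λ i _ → lem (i + i ≤? t) (i <? p) (λ i<p → ≤-trans (+-mono-≤ (<⇒≤ i<p) (<⇒≤ i<p)) (≤-trans (≤-reflexive (cong (p +_) (sym (+-identityʳ p)))) h)))) (R-lt N p p≤N)
    where
    lem : ∀ {A B : Set} (dC : Dec A) (dA : Dec B) → (B → A) → sel (does dC) (b2n (does dA)) ≡ b2n (does dA)
    lem (yes _) dA f = refl
    lem (no nc) (yes a) f = ⊥-elim (nc (f a))
    lem (no nc) (no _) f = refl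

  SUsum : ∀ N t p → 2 * p ≤ t → 2 ≤ p → p < N → R N (λ i → sel (does (i + i ≤? t)) (b2n (SU p i))) ≡ p
  SUsum N t p h p≥2 p<N = begin
    R N (λ i → sel (does (i + i ≤? t)) (b2n (SU p i))) ≡⟨ R-ext N (λ i _ → lem (i <? p ∸ 1) (i ≟ p) (i + i ≤? t) (c i) (d i)) ⟩
    R N (λ i → b2n (does (i <? p ∸ 1)) + sel (does (i ≟ p)) 1) ≡⟨ R-+ N _ _ ⟩
    R N (λ i → b2n (does (i <? p ∸ 1))) + R N (λ i → sel (does (i ≟ p)) 1) ≡⟨ cong₂ _+_ (R-lt N (p ∸ 1) (≤-trans (m∸n≤m p 1) (<⇒≤ p<N))) (R-δ N p (λ _ → 1) p<N) ⟩
    p ∸ 1 + 1 ≡⟨ m∸n+n≡m (≤-trans (s≤s z≤n) p≥2) ⟩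
    p ∎
    where
    open ≡-Reasoning
    2p≤ : p + p ≤ t
    2p≤ = ≤-trans (≤-reflexive (cong (p +_) (sym (+-identityʳ p)))) h
    c : ∀ i → (i < p ∸ 1 ⊎ i ≡ p) → i + i ≤ t
    c i (inj₁ q) = ≤-trans (+-mono-≤ i≤p i≤p) 2p≤
      where i≤p = ≤-trans (<⇒≤ q) (m∸n≤m p 1)
    c i (inj₂ refl) = 2p≤
    d : ∀ i → i < p ∸ 1 → i ≡ p → ⊥
    d i q refl = <-irrefl refl (≤-trans q (m∸n≤m p 1))
    lem : ∀ {A B C : Set} (dA : Dec A) (dB : Dec B) (dC : Dec C) → (A ⊎ B → C) → (A → B → ⊥) →
      sel (does dC) (b2n (does dA ∨ does dB)) ≡ b2n (does dA) + sel (does dB) 1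
    lem (yes a) (yes b) dC f g = ⊥-elim (g a b)
    lem (yes a) (no _) (yes _) f g = refl
    lem (yes a) (no _) (no nc) f g = ⊥-elim (nc (f (inj₁ a)))
    lem (no _) (yes b) (yes _) f g = refl
    lem (no _) (yes b) (no nc) f g = ⊥-elim (nc (f (inj₂ b)))
    lem (no _) (no _) (yes _) f g = refl
    lem (no _) (no _) (no _) f g = refl

module Monotonicity where

  open import Data.Nat
  open import Data.Nat.Properties
  open import Data.Nat.Tactic.RingSolver
  open import Data.Bool using (Bool; true; false; if_then_else_)
  open import Data.Fin as Fin using (Fin)
  open import Data.Sum using (_⊎_; inj₁; inj₂)
  open import Data.Product using (_,_)
  open import Data.Empty using (⊥; ⊥-elim)
  open import Relation.Nullary using (yes; no)
  open import Relation.Binary.PropositionalEquality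
  open import Defs using (val)
  open Summation
  open Staircase

  plus-cancel-lt : ∀ a b X Y → a + X ≡ b + Y → Y < X → a < b
  plus-cancel-lt a b X Y e Y<X with a <? b
  ... | yes h = h
  ... | no h = ⊥-elim (<-irrefl (sym e) (+-mono-≤-< (≮⇒≥ h) Y<X))

  inc-chain : ∀ N (f : ℕ → ℕ) → (∀ v → suc v < N → f v < f (suc v)) → ∀ a b → a < b → b < N → f a < f b
  inc-chain N f st a (suc b) a<sb sb<N with a <? b
  ... | yes a<b = <-trans (inc-chain N f st a b a<b (<-trans (n<1+n b) sb<N)) (st b sb<N)
  ... | no a≮b = subst (λ z → f z < f (suc b)) (sym (≤-antisym (≤-pred a<sb) (≮⇒≥ a≮b))) (st b sb<N)

  c1 c2 c3 : Fin 3
  c1 = Fin.zero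
  c2 = Fin.suc Fin.zero
  c3 = Fin.suc (Fin.suc Fin.zero)

  cellColour : Bool → Bool → Fin 3
  cellColour inD inU = if inD then c1 else (if inU then c3 else c2)

  -- The colour matrix of the construction: the staircase D = Stair N t SDf in the
  -- top-left corner gets colour 1, the mirrored staircase U = Stair N t SUf in the
  -- bottom-right corner (cells (N-1-u , N-1-v)) gets colour 3, all other cells
  -- colour 2.  As the corners are far apart (t + 2 ≤ N) the two never overlap, and
  --   σ(v) = 2N - Λ_D(v) + Λ_U(N-1-v),
  -- so σ is strictly increasing as soon as at every step one of the two column
  -- counts strictly drops ('Good').
  module TwoStairs (N t : ℕ) (SDf SUf : ℕ → Bool) (t2 : t + 2 ≤ N) where
    module D = Stair N t SDf
    module U = Stair N t SUf

    inD : ℕ → ℕ → Bool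
    inD = D.inX

    inU : ℕ → ℕ → Bool
    inU u v = U.inX (N ∸ 1 ∸ u) (N ∸ 1 ∸ v)

    col : ℕ → ℕ → Fin 3
    col u v = cellColour (inD u v) (inU u v)

    col-sym : ∀ u v → col u v ≡ col v u
    col-sym u v = cong₂ cellColour (D.inX-sym u v) (U.inX-sym (N ∸ 1 ∸ u) (N ∸ 1 ∸ v))

    t<N : t < N
    t<N = ≤-trans (≤-trans (n≤1+n (suc t)) (≤-reflexive (+-comm 2 t))) t2

    disj : ∀ u v → u < N → v < N → inD u v ≡ true → inU u v ≡ true → ⊥
    disj u v u<N v<N h1 h2 = lem N t2 u<N v<N (D.inX-le u v h1) (U.inX-le _ _ h2)
      where
      lem : ∀ N → t + 2 ≤ N → u < N → v < N → u + v ≤ t → (N ∸ 1 ∸ u) + (N ∸ 1 ∸ v) ≤ t → ⊥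
      lem (suc n) t2' (s≤s u≤n) (s≤s v≤n) a b = <-irrefl refl (≤-trans c nn≤)
        where
        e : (n ∸ u) + (n ∸ v) + (u + v) ≡ n + n
        e = trans (l (n ∸ u) (n ∸ v) u v) (cong₂ _+_ (m∸n+n≡m u≤n) (m∸n+n≡m v≤n))
          where l : ∀ a b c d → a + b + (c + d) ≡ a + c + (b + d)
                l = solve-∀
        nn≤ : n + n ≤ t + t
        nn≤ = ≤-trans (≤-reflexive (sym e)) (+-mono-≤ b a)
        st≤n : suc t ≤ n
        st≤n = ≤-pred (subst (_≤ suc n) (trans (+-suc t 1) (cong suc (+-comm t 1))) t2')
        c : suc (t + t) ≤ n + n
        c = ≤-trans (n≤1+n _) (≤-trans (≤-reflexive (cong suc (sym (+-suc t t)))) (+-mono-≤ st≤n st≤n))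

    cellValue : ∀ a b → (a ≡ true → b ≡ true → ⊥) → val (cellColour a b) + b2n a ≡ 2 + b2n b
    cellValue true true h = ⊥-elim (h refl refl)
    cellValue true false h = refl
    cellValue false true h = refl
    cellValue false false h = refl

    σ' : ℕ → ℕ
    σ' v = R N (λ u → val (col u v))

    σsum : ∀ v → v < N → σ' v + D.Λ v ≡ N * 2 + U.Λ (N ∸ 1 ∸ v)
    σsum v v<N = begin
      σ' v + D.Λ v ≡⟨ sym (R-+ N _ _) ⟩
      R N (λ u → val (col u v) + b2n (inD u v)) ≡⟨ R-ext N (λ u u<N → cellValue (inD u v) (inU u v) (disj u v u<N v<N)) ⟩
      R N (λ u → 2 + b2n (inU u v)) ≡⟨ R-+ N _ _ ⟩
      R N (λ _ → 2) + R N (λ u → b2n (inU u v)) ≡⟨ cong₂ _+_ (R-const N 2) (R-rev N (λ u' → b2n (U.inX u' (N ∸ 1 ∸ v)))) ⟩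
      N * 2 + U.Λ (N ∸ 1 ∸ v) ∎
      where open ≡-Reasoning

    σc : ∀ v → v < N → σ' v + D.Λc v ≡ N * 2 + U.Λc (N ∸ 1 ∸ v)
    σc v v<N = trans (cong (σ' v +_) (sym (D.Λ-closed t<N v))) (trans (σsum v v<N) (cong (N * 2 +_) (U.Λ-closed t<N (N ∸ 1 ∸ v))))

    Good : Set
    Good = ∀ v w → v + w + 2 ≡ N → D.Λc (suc v) < D.Λc v ⊎ U.Λc (suc w) < U.Λc w

    strict : Good → ∀ v → suc v < N → σ' v < σ' (suc v)
    strict good v sv<N with m≤n⇒∃[o]m+o≡n sv<N
    ... | k , eN = plus-cancel-lt (σ' v) (σ' (suc v)) (D.Λc v + U.Λc k) (D.Λc (suc v) + U.Λc (suc k)) eq lt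
      where
      open ≡-Reasoning
      e1 : N ∸ 1 ∸ v ≡ suc k
      e1 = trans (cong (λ z → z ∸ 1 ∸ v) (sym eN)) (trans (cong (_∸ v) (sym (+-suc v k))) (m+n∸m≡n v (suc k)))
      e2 : N ∸ 1 ∸ suc v ≡ k
      e2 = trans (cong (λ z → z ∸ 1 ∸ suc v) (sym eN)) (m+n∸m≡n v k)
      q1 : σ' v + D.Λc v ≡ N * 2 + U.Λc (suc k)
      q1 = trans (σc v (<-trans (n<1+n v) sv<N)) (cong (λ z → N * 2 + U.Λc z) e1)
      q2 : σ' (suc v) + D.Λc (suc v) ≡ N * 2 + U.Λc k
      q2 = trans (σc (suc v) sv<N) (cong (λ z → N * 2 + U.Λc z) e2)
      sw : ∀ a b c d → a + b ≡ c → a + (b + d) ≡ c + d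
      sw a b c d e = trans (sym (+-assoc a b d)) (cong (_+ d) e)
      eq : σ' v + (D.Λc v + U.Λc k) ≡ σ' (suc v) + (D.Λc (suc v) + U.Λc (suc k))
      eq = begin
        σ' v + (D.Λc v + U.Λc k) ≡⟨ sw (σ' v) (D.Λc v) _ (U.Λc k) q1 ⟩
        N * 2 + U.Λc (suc k) + U.Λc k ≡⟨ +-assoc (N * 2) _ _ ⟩
        N * 2 + (U.Λc (suc k) + U.Λc k) ≡⟨ cong (N * 2 +_) (+-comm (U.Λc (suc k)) (U.Λc k)) ⟩
        N * 2 + (U.Λc k + U.Λc (suc k)) ≡⟨ sym (+-assoc (N * 2) _ _) ⟩
        N * 2 + U.Λc k + U.Λc (suc k) ≡⟨ sym (sw (σ' (suc v)) (D.Λc (suc v)) _ (U.Λc (suc k)) q2) ⟩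
        σ' (suc v) + (D.Λc (suc v) + U.Λc (suc k)) ∎
      ek : v + k + 2 ≡ N
      ek = trans (trans (+-assoc v k 2) (trans (cong (v +_) (+-comm k 2)) (+-suc v (suc k)))) (trans (cong suc (+-suc v k)) eN)
      lt : D.Λc (suc v) + U.Λc (suc k) < D.Λc v + U.Λc k
      lt with good v k ek
      ... | inj₁ a = +-mono-<-≤ a (U.Λc-mono k)
      ... | inj₂ b = +-mono-≤-< (D.Λc-mono v) b

module Construction where

  open import Data.Nat
  open import Data.Nat.Properties
  open import Data.Nat.Tactic.RingSolver
  open import Data.Bool using (Bool; true; false)
  open import Data.Fin as Fin using (Fin; toℕ)
  open import Data.Fin.Properties using (toℕ<n)
  open import Data.Product using (_×_; _,_; proj₁; proj₂)
  open import Data.Sum using (inj₁; inj₂)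
  open import Data.Empty using (⊥; ⊥-elim)
  open import Relation.Nullary using (Dec; yes; no; does)
  open import Relation.Nullary.Decidable using (dec-true)
  open import Relation.Binary.PropositionalEquality
  open import Defs
  open Summation hiding (δ)
  open CompleteGraph
  open Colourings
  open Parameters
  open Staircase
  open StaircaseCounting
  open Monotonicity

  pairedColumns : ∀ v w p N t → v + w + 2 ≡ N → N + p ≤ 2 * t + 2 → v + w + p ≤ 2 * t
  pairedColumns v w p N t e h = +-cancelʳ-≤ 2 _ _ (≤-trans (≤-reflexive (l v w p)) (≤-trans (≤-reflexive (cong (_+ p) e)) h))
    where l : ∀ v w p → v + w + p + 2 ≡ v + w + 2 + p
          l = solve-∀

  pairedColumnsGlitch : ∀ v w p N t → v + w + 2 ≡ N → N + 2 * p ≡ 2 * t + 2 → v + w + 2 * p ≡ 2 * t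
  pairedColumnsGlitch v w p N t e g = +-cancelʳ-≡ 2 _ _ (trans (l v w p) (trans (cong (_+ 2 * p) e) g))
    where l : ∀ v w p → v + w + 2 * p + 2 ≡ v + w + 2 + 2 * p
          l = solve-∀

  -- In the regular case both use the filling
  -- SD p; in the glitch case N + 2p = 2t + 2 the bottom-right one uses SU p.
  module Goods (N t p : ℕ) (t2 : t + 2 ≤ N) (hp : 2 * p ≤ t) (ha : N + p ≤ 2 * t + 2) where
    module D = Stair N t (SD p)
    module U = Stair N t (SU p)

    SD-corner : 0 < p → SD p 0 ≡ true
    SD-corner 0<p = dec-true (0 <? p) 0<p

    cornerDrop : 0 < p → D.Λc (suc t) < D.Λc t
    cornerDrop 0<p = D.Λc-strict-at-t (SD-corner 0<p)

    t<v⇒wp<t : ∀ v w → v + w + 2 ≡ N → t < v → w + p < t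
    t<v⇒wp<t v w e t<v = +-cancelˡ-≤ t (suc (w + p)) t (≤-trans (≤-reflexive (l t w p))
      (≤-trans (+-monoˡ-≤ (w + p) t<v) (≤-trans (≤-reflexive (sym (+-assoc v w p))) (≤-trans (pairedColumns v w p N t e ha) (≤-reflexive (l2 t))))))
      where l : ∀ t w p → t + suc (w + p) ≡ suc t + (w + p)
            l = solve-∀
            l2 : ∀ t → 2 * t ≡ t + t
            l2 = solve-∀

    goodD-gap : N + 2 * p ≢ 2 * t + 2 → ∀ v w → v + w + 2 ≡ N → v + p ≡ t → D.Λc (suc w) < D.Λc w
    goodD-gap ng v w e vp with w <? t
    ... | yes w<t = strictD N t p w w<t (λ wp → ng (glitch (+-cancelʳ-≡ p v w (trans vp (sym wp)))))
      where
      glitch : v ≡ w → N + 2 * p ≡ 2 * t + 2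
      glitch refl = trans (cong (_+ 2 * p) (sym e)) (trans (l v p) (cong (λ z → 2 * z + 2) vp))
        where l : ∀ v p → v + v + 2 + 2 * p ≡ 2 * (v + p) + 2
              l = solve-∀
    ... | no w≮t = subst (λ z → D.Λc (suc z) < D.Λc z) (sym w≡t) (cornerDrop 0<p)
      where
      w≤t : w ≤ t
      w≤t = +-cancelˡ-≤ t w t (≤-trans (≤-reflexive (trans (cong (_+ w) (sym vp)) (l v p w))) (≤-trans (pairedColumns v w p N t e ha) (≤-reflexive (l2 t))))
        where l : ∀ v p w → v + p + w ≡ v + w + p
              l = solve-∀
              l2 : ∀ t → 2 * t ≡ t + t
              l2 = solve-∀
      w≡t : w ≡ t
      w≡t = ≤-antisym w≤t (≮⇒≥ w≮t)
      0<p : 0 < p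
      0<p = n≢0⇒n>0 (λ p0 → ng (trans (cong (_+ 2 * p) (sym e)) (hl v w p t vp w≡t p0)))
        where hl : ∀ v w p t → v + p ≡ t → w ≡ t → p ≡ 0 → v + w + 2 + 2 * p ≡ 2 * t + 2
              hl v w zero .(v + 0) refl refl refl = l v
                where l : ∀ v → v + (v + 0) + 2 + 2 * 0 ≡ 2 * (v + 0) + 2
                      l = solve-∀

    goodD : N + 2 * p ≢ 2 * t + 2 → TwoStairs.Good N t (SD p) (SD p) t2
    goodD ng v w e with v <? t | v + p ≟ t
    ... | yes v<t | no ne = inj₁ (strictD N t p v v<t ne)
    ... | _ | yes vp = inj₂ (goodD-gap ng v w e vp)
    ... | no v≮t | no ne with v ≟ t
    ...   | yes refl = inj₁ (cornerDrop (n≢0⇒n>0 (λ p0 → ne (trans (cong (v +_) p0) (+-identityʳ v)))))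
    ...   | no v≢t = inj₂ (strictD N t p w (≤-<-trans (m≤m+n w p) wp<t) (λ x → <-irrefl x wp<t))
      where
      wp<t : w + p < t
      wp<t = t<v⇒wp<t v w e (≤∧≢⇒< (≮⇒≥ v≮t) (λ x → v≢t (sym x)))

    goodU-gap : N + 2 * p ≡ 2 * t + 2 → 2 ≤ p → ∀ v w → v + w + 2 ≡ N → v + p ≡ t → U.Λc (suc w) < U.Λc w
    goodU-gap g p≥2 v w e vp = strictU N t p w w<t n1 n2 n3
      where
      wp : w + p ≡ t
      wp = +-cancelˡ-≡ t _ _ (trans (trans (cong (_+ (w + p)) (sym vp)) (l v w p)) (trans (pairedColumnsGlitch v w p N t e g) (l2 t)))
        where l : ∀ v w p → v + p + (w + p) ≡ v + w + 2 * p
              l = solve-∀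
              l2 : ∀ t → 2 * t ≡ t + t
              l2 = solve-∀
      w<t : w < t
      w<t = subst (w <_) wp (≤-trans (≤-reflexive (+-comm 1 w)) (+-monoʳ-≤ w (≤-trans (s≤s z≤n) p≥2)))
      n1 : suc w ≢ p
      n1 sw = <-irrefl refl (≤-trans (≤-reflexive sw) (+-cancelʳ-≤ p p w (≤-trans (≤-reflexive (l p)) (≤-trans hp (≤-reflexive (sym wp))))))
        where l : ∀ p → p + p ≡ 2 * p
              l = solve-∀
      n2 : suc w + p ≢ t
      n2 x = <-irrefl (trans wp (sym x)) (n<1+n (w + p))
      n3 : w + p ≢ t + 1
      n3 x = <-irrefl (trans (sym wp) x) (subst (t <_) (+-comm 1 t) (n<1+n t))

    goodU-beyond : N + 2 * p ≡ 2 * t + 2 → t < 3 * p → 2 ≤ p → ∀ v w → v + w + 2 ≡ N → t < v → U.Λc (suc w) < U.Λc w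
    goodU-beyond g t<3p p≥2 v w e t<v = strictU N t p w w<t n1 n2 n3
      where
      w2p<t : w + 2 * p < t
      w2p<t = +-cancelˡ-≤ t (suc (w + 2 * p)) t (≤-trans (≤-reflexive (l t w p)) (≤-trans (+-monoˡ-≤ (w + 2 * p) t<v) (≤-reflexive (trans (sym (+-assoc v w (2 * p))) (trans (pairedColumnsGlitch v w p N t e g) (l2 t))))))
        where l : ∀ t w p → t + suc (w + 2 * p) ≡ suc t + (w + 2 * p)
              l = solve-∀
              l2 : ∀ t → 2 * t ≡ t + t
              l2 = solve-∀
      w<t : w < t
      w<t = ≤-<-trans (m≤m+n w (2 * p)) w2p<t
      n1 : suc w ≢ p
      n1 sw = <-irrefl refl (≤-<-trans 3p≤t t<3p)
        where
        l : ∀ p → p + 2 * p ≡ 3 * p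
        l = solve-∀
        3p≤t : 3 * p ≤ t
        3p≤t = ≤-trans (≤-reflexive (trans (sym (l p)) (cong (_+ 2 * p) (sym sw)))) w2p<t
      n2 : suc w + p ≢ t
      n2 x = <-irrefl x lt
        where
        l1 : ∀ w p → suc (suc w + p) ≡ suc w + p + 1
        l1 = solve-∀
        l2 : ∀ w p → suc w + p + p ≡ suc (w + 2 * p)
        l2 = solve-∀
        lt : suc w + p < t
        lt = ≤-trans (≤-reflexive (l1 w p)) (≤-trans (+-monoʳ-≤ (suc w + p) (≤-trans (s≤s z≤n) p≥2)) (≤-trans (≤-reflexive (l2 w p)) w2p<t))
      n3 : w + p ≢ t + 1
      n3 x = <-irrefl x (≤-trans (s≤s (≤-trans (+-monoʳ-≤ w (m≤m+n p (p + 0))) (<⇒≤ w2p<t))) (≤-reflexive (+-comm 1 t)))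

    goodU : N + 2 * p ≡ 2 * t + 2 → t < 3 * p → 2 ≤ p → TwoStairs.Good N t (SD p) (SU p) t2
    goodU g t<3p p≥2 v w e with v <? t | v + p ≟ t
    ... | yes v<t | no ne = inj₁ (strictD N t p v v<t ne)
    ... | _ | yes vp = inj₂ (goodU-gap g p≥2 v w e vp)
    ... | no v≮t | no ne with v ≟ t
    ...   | yes refl = inj₁ (cornerDrop (≤-trans (s≤s z≤n) p≥2))
    ...   | no v≢t = inj₂ (goodU-beyond g t<3p p≥2 v w e (≤∧≢⇒< (≮⇒≥ v≮t) (λ x → v≢t (sym x))))

  -- Counting the upper triangle of a symmetric matrix is invariant under the
  -- mirror (i , j) ↦ (N-1-i , N-1-j); this moves the colour-3 staircase to the corner.
  mirrorCount : ∀ N (h : ℕ → ℕ → ℕ) → (∀ i j → h i j ≡ h j i) →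
    R N (λ i → R N (λ j → sel (does (i ≤? j)) (h (N ∸ 1 ∸ i) (N ∸ 1 ∸ j)))) ≡ R N (λ i → R N (λ j → sel (does (i ≤? j)) (h i j)))
  mirrorCount N h hs = begin
    R N (λ i → R N (λ j → sel (does (i ≤? j)) (h (N ∸ 1 ∸ i) (N ∸ 1 ∸ j))))
      ≡⟨ R-ext N (λ i i<N → R-ext N (λ j j<N → cong (λ b → sel b (h (N ∸ 1 ∸ i) (N ∸ 1 ∸ j)))
           (doesEq (i ≤? j) ((N ∸ 1 ∸ j) ≤? (N ∸ 1 ∸ i)) (∸-monoʳ-≤ (N ∸ 1)) (∸-cancelʳ-≤ (<⇒≤pred i<N))))) ⟩
    R N (λ i → R N (λ j → f (N ∸ 1 ∸ i) (N ∸ 1 ∸ j))) ≡⟨ R-ext N (λ i _ → R-rev N (f (N ∸ 1 ∸ i))) ⟩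
    R N (λ i → R N (λ j → f (N ∸ 1 ∸ i) j)) ≡⟨ R-rev N (λ a → R N (f a)) ⟩
    R N (λ i → R N (λ j → f i j)) ≡⟨ R-swap N N f ⟩
    R N (λ j → R N (λ i → f i j)) ≡⟨ R-ext N (λ j _ → R-ext N (λ i _ → cong (sel (does (j ≤? i))) (hs i j))) ⟩
    R N (λ i → R N (λ j → sel (does (i ≤? j)) (h i j))) ∎
    where
    open ≡-Reasoning
    f : ℕ → ℕ → ℕ
    f a b = sel (does (b ≤? a)) (h a b)

  ind-c1 : ∀ a b → ind (cellColour a b) c1 ≡ b2n a
  ind-c1 true b = refl
  ind-c1 false true = refl
  ind-c1 false false = refl

  ind-c3 : ∀ a b → (a ≡ true → b ≡ true → ⊥) → ind (cellColour a b) c3 ≡ b2n b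
  ind-c3 true true h = ⊥-elim (h refl refl)
  ind-c3 true false h = refl
  ind-c3 false true h = refl
  ind-c3 false false h = refl

  indSum : ∀ (x : Fin 3) → ind x c1 + ind x c2 + ind x c3 ≡ 1
  indSum Fin.zero = refl
  indSum (Fin.suc Fin.zero) = refl
  indSum (Fin.suc (Fin.suc Fin.zero)) = refl

  module ThreeColouring (N t p δ : ℕ) (t2 : t + 2 ≤ N) (hp : 2 * p ≤ t) (δ≤1 : δ ≤ 1) (eqT : Tr N ≡ 3 * (F t + p) + δ)
            (SUf : ℕ → Bool) (good : TwoStairs.Good N t (SD p) SUf t2)
            (ucount : R N (λ i → sel (does (i + i ≤? t)) (b2n (SUf i))) ≡ p) where
    open TwoStairs N t (SD p) SUf t2

    γ : TotalColouring (K N) 3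
    γ = mkCol N 3 col

    σγ : ∀ v → σT γ v ≡ σ' (toℕ v)
    σγ v = σ-mk N 3 col col-sym v

    -- σ is strictly increasing in the label, so adjacent vertices differ
    nsd : NeighbourSumDistinguishing γ
    nsd e eq = <-irrefl (trans (sym (σγ _)) (trans eq (σγ _))) (inc-chain N σ' (strict good) _ _ (edge-lt N e) (toℕ<n _))

    X : ℕ
    X = F t + p

    p≤N : p ≤ N
    p≤N = ≤-trans (m≤n+m p p) (≤-trans (≤-reflexive (cong (p +_) (sym (+-identityʳ p)))) (≤-trans hp (≤-trans (m≤m+n t 2) t2)))

    count-c1 : count γ c1 ≡ X
    count-c1 = begin
      count γ c1 ≡⟨ count-mk N 3 col c1 ⟩
      R N (λ i → R N (λ j → sel (does (i ≤? j)) (ind (col i j) c1))) ≡⟨ R-ext N (λ i _ → R-ext N (λ j _ → cong (sel (does (i ≤? j))) (ind-c1 (inD i j) (inU i j)))) ⟩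
      R N (λ i → R N (λ j → sel (does (i ≤? j)) (b2n (inD i j)))) ≡⟨ stairCount N t (SD p) t<N ⟩
      F t + R N (λ i → sel (does (i + i ≤? t)) (b2n (SD p i))) ≡⟨ cong (F t +_) (SDsum N t p hp p≤N) ⟩
      X ∎
      where open ≡-Reasoning

    count-c3 : count γ c3 ≡ X
    count-c3 = begin
      count γ c3 ≡⟨ count-mk N 3 col c3 ⟩
      R N (λ i → R N (λ j → sel (does (i ≤? j)) (ind (col i j) c3))) ≡⟨ R-ext N (λ i i<N → R-ext N (λ j j<N → cong (sel (does (i ≤? j))) (ind-c3 (inD i j) (inU i j) (disj i j i<N j<N)))) ⟩
      R N (λ i → R N (λ j → sel (does (i ≤? j)) (b2n (inU i j)))) ≡⟨ mirrorCount N (λ a b → b2n (U.inX a b)) (λ a b → cong b2n (U.inX-sym a b)) ⟩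
      R N (λ i → R N (λ j → sel (does (i ≤? j)) (b2n (U.inX i j)))) ≡⟨ stairCount N t SUf t<N ⟩
      F t + R N (λ i → sel (does (i + i ≤? t)) (b2n (SUf i))) ≡⟨ cong (F t +_) ucount ⟩
      X ∎
      where open ≡-Reasoning

    csum : count γ c1 + count γ c2 + count γ c3 ≡ Tr N
    csum = begin
      count γ c1 + count γ c2 + count γ c3 ≡⟨ cong₂ _+_ (cong₂ _+_ (count-mk N 3 col c1) (count-mk N 3 col c2)) (count-mk N 3 col c3) ⟩
      A c1 + A c2 + A c3 ≡⟨ cong (_+ A c3) (sym (R-+ N _ _)) ⟩
      R N (λ i → R N (λ j → sel (does (i ≤? j)) (ind (col i j) c1))  + R N (λ j → sel (does (i ≤? j)) (ind (col i j) c2))) + A c3 ≡⟨ sym (R-+ N _ _) ⟩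
      R N (λ i → R N (λ j → sel (does (i ≤? j)) (ind (col i j) c1))  + R N (λ j → sel (does (i ≤? j)) (ind (col i j) c2)) + R N (λ j → sel (does (i ≤? j)) (ind (col i j) c3)))
        ≡⟨ R-ext N (λ i _ → trans (cong (_+ R N (λ j → sel (does (i ≤? j)) (ind (col i j) c3))) (sym (R-+ N _ _))) (sym (R-+ N _ _))) ⟩
      R N (λ i → R N (λ j → sel (does (i ≤? j)) (ind (col i j) c1) + sel (does (i ≤? j)) (ind (col i j) c2) + sel (does (i ≤? j)) (ind (col i j) c3)))
        ≡⟨ R-ext N (λ i _ → R-ext N (λ j _ → trans (sym (trans (sel-+ (does (i ≤? j)) _ _) (cong (_+ sel (does (i ≤? j)) (ind (col i j) c3)) (sel-+ (does (i ≤? j)) _ _)))) (cong (sel (does (i ≤? j))) (indSum (col i j))))) ⟩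
      R N (λ i → R N (λ j → sel (does (i ≤? j)) 1)) ≡⟨ pairsCount N ⟩
      Tr N ∎
      where
      open ≡-Reasoning
      A : Fin 3 → ℕ
      A c = R N (λ i → R N (λ j → sel (does (i ≤? j)) (ind (col i j) c)))

    count-c2 : count γ c2 ≡ X + δ
    count-c2 = +-cancelˡ-≡ (X + X) _ _ (begin
      X + X + count γ c2 ≡⟨ l X (count γ c2) ⟩
      X + count γ c2 + X ≡⟨ sym (cong₂ (λ a b → a + count γ c2 + b) count-c1 count-c3) ⟩
      count γ c1 + count γ c2 + count γ c3 ≡⟨ csum ⟩
      Tr N ≡⟨ eqT ⟩
      3 * X + δ ≡⟨ l2 X δ ⟩
      X + X + (X + δ) ∎)
      where
      open ≡-Reasoning
      l : ∀ a b → a + a + b ≡ a + b + a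
      l = solve-∀
      l2 : ∀ a d → 3 * a + d ≡ a + a + (a + d)
      l2 = solve-∀

    bounds : ∀ c → X ≤ count γ c × count γ c ≤ suc X
    bounds Fin.zero = ≤-reflexive (sym count-c1) , ≤-trans (≤-reflexive count-c1) (n≤1+n X)
    bounds (Fin.suc Fin.zero) = ≤-trans (m≤m+n X δ) (≤-reflexive (sym count-c2)) , ≤-trans (≤-reflexive count-c2) (≤-trans (+-monoʳ-≤ X δ≤1) (≤-reflexive (+-comm X 1)))
    bounds (Fin.suc (Fin.suc Fin.zero)) = ≤-reflexive (sym count-c3) , ≤-trans (≤-reflexive count-c3) (n≤1+n X)

    equit : Equitable γ
    equit c d = ≤-trans (proj₂ (bounds c)) (s≤s (proj₁ (bounds d)))

    admits : AdmitsENSDT (K N) 3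
    admits = γ , nsd , equit

  upperBound5 : ∀ N → 5 ≤ N → AdmitsENSDT (K N) 3
  upperBound5 N h = go (N + 2 * p ≟ 2 * t + 2)
    where
    P : Params N
    P = params N h
    open Params P
    p≤t : p ≤ t
    p≤t = ≤-trans (m≤m+n p (p + 0)) hp
    t<N : t < N
    t<N = ≤-trans (≤-trans (n≤1+n (suc t)) (≤-reflexive (+-comm 2 t))) ht
    go : Dec (N + 2 * p ≡ 2 * t + 2) → AdmitsENSDT (K N) 3
    go (yes g) = ThreeColouring.admits N t p δ ht hp δ≤1 eqT (SU p) (Goods.goodU N t p ht hp ha g (proj₁ (hg g)) (proj₂ (hg g))) (SUsum N t p hp (proj₂ (hg g)) (≤-<-trans p≤t t<N))
    go (no ng) = ThreeColouring.admits N t p δ ht hp δ≤1 eqT (SD p) (Goods.goodD N t p ht hp ha ng) (SDsum N t p hp (≤-trans p≤t (<⇒≤ t<N)))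

module Pigeonhole where

  open import Data.Nat
  open import Data.Nat.Properties
  open import Data.Nat.Tactic.RingSolver
  open import Data.Fin as Fin using (Fin; toℕ; fromℕ<; punchIn; punchOut)
  open import Data.Fin.Properties using (pigeonhole; punchIn-injective; punchInᵢ≢i; punchOut-injective; punchIn-punchOut; toℕ-fromℕ<; any?)
  open import Data.Product using (Σ; _×_; _,_)
  open import Data.Empty using (⊥; ⊥-elim)
  open import Relation.Nullary using (yes; no)
  open import Relation.Binary.PropositionalEquality
  open import Function using (_∘_)
  open import Function.Definitions using (Injective)
  open import Algebra.Properties.CommutativeMonoid.Sum +-0-commutativeMonoid using (sum-remove)
  open Summation

  noInjLess : ∀ k (e : Fin (suc k) → ℕ) → Injective _≡_ _≡_ e → (∀ i → e i < k) → ⊥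
  noInjLess k e inj bd with pigeonhole (n<1+n k) (λ i → fromℕ< (bd i))
  ... | i , j , i<j , eq = <-irrefl (cong toℕ (inj (trans (sym (toℕ-fromℕ< (bd i))) (trans (cong toℕ eq) (toℕ-fromℕ< (bd j)))))) i<j

  injectiveSumBound : ∀ n (e : Fin n → ℕ) → Injective _≡_ _≡_ e → (∀ i → e i < n) → S n e * 2 + n ≤ n * n
  injectiveSumBound zero e inj bd = z≤n
  injectiveSumBound (suc k) e inj bd with any? (λ i → e i ≟ k)
  ... | no none = ⊥-elim (noInjLess k e inj (λ i → ≤∧≢⇒< (≤-pred (bd i)) (λ x → none (i , x))))
  ... | yes (i0 , ei0) = begin
      S (suc k) e * 2 + suc k ≡⟨ cong (λ z → z * 2 + suc k) (sum-remove {i = i0} e) ⟩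
      (e i0 + S k e') * 2 + suc k ≡⟨ cong (λ z → (z + S k e') * 2 + suc k) ei0 ⟩
      (k + S k e') * 2 + suc k ≡⟨ l k (S k e') ⟩
      (S k e' * 2 + k) + (2 * k + 1) ≤⟨ +-monoˡ-≤ (2 * k + 1) (injectiveSumBound k e' inj' bd') ⟩
      k * k + (2 * k + 1) ≡⟨ l2 k ⟩
      suc k * suc k ∎
    where
    open ≤-Reasoning
    e' : Fin k → ℕ
    e' = e ∘ punchIn i0
    inj' : Injective _≡_ _≡_ e'
    inj' {i} {j} h = punchIn-injective i0 i j (inj h)
    bd' : ∀ j → e' j < k
    bd' j = ≤∧≢⇒< (≤-pred (bd (punchIn i0 j))) (λ x → punchInᵢ≢i i0 j (inj (trans x (sym ei0))))
    l : ∀ k s → (k + s) * 2 + suc k ≡ (s * 2 + k) + (2 * k + 1)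
    l = solve-∀
    l2 : ∀ k → k * k + (2 * k + 1) ≡ suc k * suc k
    l2 = solve-∀

  twoMissing : ∀ n (d : Fin n → ℕ) → Injective _≡_ _≡_ d → (∀ i → d i ≤ n) → ∀ k1 k2 → k1 ≤ n → k2 ≤ n → k1 ≢ k2 →
    (∀ i → d i ≢ k1) → (∀ i → d i ≢ k2) → ⊥
  twoMissing zero d inj bd k1 k2 z≤n z≤n ne _ _ = ne refl
  twoMissing (suc n) d inj bd k1 k2 h1 h2 ne m1 m2 = final (pigeonhole (n<1+n n) f2)
    where
    K1 K2 : Fin (suc (suc n))
    K1 = fromℕ< (s≤s h1)
    K2 = fromℕ< (s≤s h2)
    D : Fin (suc n) → Fin (suc (suc n))
    D i = fromℕ< (s≤s (bd i))
    tD : ∀ i → toℕ (D i) ≡ d i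
    tD i = toℕ-fromℕ< (s≤s (bd i))
    K1≢K2 : K1 ≢ K2
    K1≢K2 x = ne (trans (sym (toℕ-fromℕ< (s≤s h1))) (trans (cong toℕ x) (toℕ-fromℕ< (s≤s h2))))
    K1≢D : ∀ i → K1 ≢ D i
    K1≢D i x = m1 i (trans (sym (tD i)) (trans (cong toℕ (sym x)) (toℕ-fromℕ< (s≤s h1))))
    f1 : Fin (suc n) → Fin (suc n)
    f1 i = punchOut (K1≢D i)
    K2' : Fin (suc n)
    K2' = punchOut K1≢K2
    K2'≢f1 : ∀ i → K2' ≢ f1 i
    K2'≢f1 i x = m2 i (trans (sym (tD i)) (trans (cong toℕ (sym (punchOut-injective K1≢K2 (K1≢D i) x))) (toℕ-fromℕ< (s≤s h2))))
    f2 : Fin (suc n) → Fin n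
    f2 i = punchOut (K2'≢f1 i)
    final : (Σ (Fin (suc n)) λ i → Σ (Fin (suc n)) λ j → i Fin.< j × f2 i ≡ f2 j) → ⊥
    final (i , j , i<j , eq) = <-irrefl (cong toℕ (inj (trans (sym (toℕ-fromℕ< (s≤s (bd i)))) (trans (cong toℕ Deq) (toℕ-fromℕ< (s≤s (bd j))))))) i<j
      where
      Deq : D i ≡ D j
      Deq = punchOut-injective (K1≢D i) (K1≢D j) (punchOut-injective (K2'≢f1 i) (K2'≢f1 j) eq)

  present : ∀ n (d : Fin n → ℕ) → Injective _≡_ _≡_ d → (∀ i → d i ≤ n) → ∀ k1 k2 → k1 ≤ n → k2 ≤ n → k1 ≢ k2 →
    (∀ i → d i ≢ k1) → Σ (Fin n) (λ i → d i ≡ k2)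
  present n d inj bd k1 k2 h1 h2 ne m1 with any? (λ i → d i ≟ k2)
  ... | yes r = r
  ... | no nr = ⊥-elim (twoMissing n d inj bd k1 k2 h1 h2 ne m1 (λ i x → nr (i , x)))

  S-ge1 : ∀ n (f : Fin n → ℕ) i → f i ≤ S n f
  S-ge1 (suc n) f i = ≤-trans (m≤m+n (f i) _) (≤-reflexive (sym (sum-remove {i = i} f)))

  S-ge2 : ∀ n (f : Fin n → ℕ) i j → i ≢ j → f i + f j ≤ S n f
  S-ge2 (suc n) f i j ne = ≤-trans (+-monoʳ-≤ (f i) (≤-trans (≤-reflexive (cong f (sym (punchIn-punchOut ne)))) (S-ge1 n (f ∘ punchIn i) (punchOut ne)))) (≤-reflexive (sym (sum-remove {i = i} f)))

module TwoColourLowerBound where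

  open import Data.Nat
  open import Data.Nat.Properties
  open import Data.Nat.Tactic.RingSolver
  open import Data.Bool using (true; false)
  open import Data.Fin as Fin using (Fin; toℕ)
  open import Data.Fin.Properties using (any?; toℕ-fromℕ<; toℕ<n) renaming (_≟_ to _≟F_)
  open import Data.Product using (Σ; _×_; _,_; proj₁; proj₂)
  open import Data.Sum using (_⊎_; inj₁; inj₂)
  open import Data.Empty using (⊥; ⊥-elim)
  open import Relation.Nullary using (yes; no; does; ¬_)
  open import Relation.Binary.PropositionalEquality
  open import Function.Definitions using (Injective)
  open import Algebra.Properties.CommutativeMonoid.Sum +-0-commutativeMonoid using (sum-cong-≗; ∑-distrib-+; ∑-comm)
  open import Defs
  open Summation
  open CompleteGraph
  open Colourings
  open Pigeonhole

  fin2≤1 : ∀ (x : Fin 2) → toℕ x ≤ 1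
  fin2≤1 x = ≤-pred (toℕ<n x)

  selT : ∀ b x → sel b 1 ≡ 1 → sel b x ≡ x
  selT true x _ = refl
  selT false x ()

  selComp : ∀ b x → x ≤ 1 → sel b x + sel b (1 ∸ x) ≡ sel b 1
  selComp true zero _ = refl
  selComp true (suc zero) _ = refl
  selComp true (suc (suc x)) (s≤s ())
  selComp false x _ = refl

  ind1 : ∀ (x : Fin 2) → ind x (Fin.suc Fin.zero) ≡ toℕ x
  ind1 Fin.zero = refl
  ind1 (Fin.suc Fin.zero) = refl

  ind01 : ∀ (x : Fin 2) → ind x Fin.zero + ind x (Fin.suc Fin.zero) ≡ 1
  ind01 Fin.zero = refl
  ind01 (Fin.suc Fin.zero) = refl

  -- No equitable neighbour-sum-distinguishing total 2-colouring of K N, N ≥ 3.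
  -- Write bv v ∈ {0,1} for the colour of v minus one, one v / zer v for the
  -- numbers of edges at v of colour 2 / 1, and d v = bv v + one v.  Every vertex
  -- has degree N - 1, so σ(v) = N + d v with 0 ≤ d v ≤ N, and d is injective on
  -- the N vertices.  Hence d misses exactly one value of [0, N]; the two cases
  -- 'd misses N' and 'd misses 0' are refuted using equitability.
  module NoTwoColouring (N : ℕ) (N≥3 : 3 ≤ N) (γ : TotalColouring (K N) 2) (nsd : NeighbourSumDistinguishing γ) (eqt : Equitable γ) where
    M : ℕ
    M = m (K N)
    ed : Fin M → Fin N × Fin N
    ed = edge (K N)

    bv : Fin N → ℕ
    bv v = toℕ (vcol γ v)
    be : Fin M → ℕ
    be e = toℕ (ecol γ e)

    one zer : Fin N → ℕ
    one v = S M (λ e → incS N v e (be e))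
    zer v = S M (λ e → incS N v e (1 ∸ be e))

    one+zer : ∀ v → one v + zer v ≡ deg N v
    one+zer v = trans (sym (∑-distrib-+ {M} _ _)) (sum-cong-≗ {M} (λ e → selComp (does (incident? v (ed e))) (be e) (fin2≤1 (ecol γ e))))

    d : Fin N → ℕ
    d v = bv v + one v

    σd : ∀ v → σT γ v ≡ N + d v
    σd v = begin
      σT γ v ≡⟨ sigmaS γ v ⟩
      suc (bv v) + S M (λ e → incS N v e (suc (be e))) ≡⟨ cong (suc (bv v) +_) (trans (sum-cong-≗ {M} (λ e → sel-+' (does (incident? v (ed e))) (be e))) (∑-distrib-+ {M} _ _)) ⟩
      suc (bv v) + (deg N v + one v) ≡⟨ l (bv v) (deg N v) (one v) ⟩
      suc (deg N v) + (bv v + one v) ≡⟨ cong (_+ d v) (deg+1 N v) ⟩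
      N + d v ∎
      where
      open ≡-Reasoning
      sel-+' : ∀ b x → sel b (suc x) ≡ sel b 1 + sel b x
      sel-+' true x = refl
      sel-+' false x = refl
      l : ∀ a b c → suc a + (b + c) ≡ suc b + (a + c)
      l = solve-∀

    degN : ∀ v → deg N v ≡ N ∸ 1
    degN v = trans (sym (m+n∸m≡n 1 (deg N v))) (cong (_∸ 1) (deg+1 N v))

    -- adjacent vertices, i.e. all pairs of vertices, have different sums
    dinj : Injective _≡_ _≡_ d
    dinj {a} {b} eq with a ≟F b
    ... | yes p = p
    ... | no ne with edgeBetween N a b ne
    ...   | e , inj₁ (p , q) = ⊥-elim (nsd e (trans (cong (σT γ) p) (trans (σd a) (trans (cong (N +_) eq) (trans (sym (σd b)) (cong (σT γ) (sym q)))))))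
    ...   | e , inj₂ (p , q) = ⊥-elim (nsd e (trans (cong (σT γ) p) (trans (σd b) (trans (cong (N +_) (sym eq)) (trans (sym (σd a)) (cong (σT γ) (sym q)))))))

    one≤deg : ∀ v → one v ≤ deg N v
    one≤deg v = ≤-trans (m≤m+n (one v) (zer v)) (≤-reflexive (one+zer v))

    d≤N : ∀ v → d v ≤ N
    d≤N v = ≤-trans (+-mono-≤ (fin2≤1 (vcol γ v)) (one≤deg v)) (≤-reflexive (deg+1 N v))

    zerAt2 : ∀ v e0 e1 → e0 ≢ e1 → incS N v e0 1 ≡ 1 → incS N v e1 1 ≡ 1 → be e0 ≡ 0 → be e1 ≡ 0 → 2 ≤ zer v
    zerAt2 v e0 e1 ne i0 i1 b0 b1 = ≤-trans (≤-reflexive (sym (cong₂ _+_ (trans (cong (incS N v e0) (cong (1 ∸_) b0)) i0) (trans (cong (incS N v e1) (cong (1 ∸_) b1)) i1)))) (S-ge2 M (λ e → incS N v e (1 ∸ be e)) e0 e1 ne)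

    oneAt2 : ∀ v e0 e1 → e0 ≢ e1 → incS N v e0 1 ≡ 1 → incS N v e1 1 ≡ 1 → be e0 ≡ 1 → be e1 ≡ 1 → 2 ≤ one v
    oneAt2 v e0 e1 ne i0 i1 b0 b1 = ≤-trans (≤-reflexive (sym (cong₂ _+_ (trans (cong (incS N v e0) b0) i0) (trans (cong (incS N v e1) b1) i1)))) (S-ge2 M (λ e → incS N v e (be e)) e0 e1 ne)

    zerZero : ∀ v e → zer v ≡ 0 → incS N v e 1 ≡ 1 → be e ≡ 1
    zerZero v e z i with n≤1⇒n≡0∨n≡1 (fin2≤1 (ecol γ e))
    ... | inj₂ p = p
    ... | inj₁ p = ⊥-elim (1≢0 (trans (sym (trans (cong (incS N v e) (cong (1 ∸_) p)) i)) (S-zero-each M _ z e)))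
      where 1≢0 : 1 ≢ 0
            1≢0 ()

    oneZero : ∀ v e → one v ≡ 0 → incS N v e 1 ≡ 1 → be e ≡ 0
    oneZero v e z i = trans (sym (selT (does (incident? v (ed e))) (be e) i)) (S-zero-each M _ z e)

    topZer : ∀ v → d v ≡ N → zer v ≡ 0 × bv v ≡ 1
    topZer v dv with n≤1⇒n≡0∨n≡1 (fin2≤1 (vcol γ v))
    ... | inj₁ b0 = ⊥-elim (<-irrefl refl (≤-trans (≤-reflexive (trans (deg+1 N v) (sym onev))) (one≤deg v)))
      where onev : one v ≡ N
            onev = trans (sym (cong (_+ one v) b0)) dv
    ... | inj₂ b1 = +-cancelˡ-≡ (one v) (zer v) 0 (trans (one+zer v) (trans (+-cancelˡ-≡ 1 (deg N v) (one v) (trans (deg+1 N v) (trans (sym dv) (cong (_+ one v) b1)))) (sym (+-identityʳ (one v))))) , b1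

    botOne : ∀ v → d v ≡ 0 → one v ≡ 0 × bv v ≡ 0
    botOne v dv = m+n≡0⇒n≡0 (bv v) dv , m+n≡0⇒m≡0 (bv v) dv

    -- x vertices and y edges have colour 2; Σ d = x + 2y counts every edge twice
    x y : ℕ
    x = S N bv
    y = S M be

    sumd : S N d ≡ x + (y + y)
    sumd = trans (∑-distrib-+ {N} bv one) (cong (x +_) (trans (∑-comm {N} {M} _) (trans (sum-cong-≗ {M} (λ e → endsSum N e (be e))) (∑-distrib-+ {M} be be))))

    MMN : M + M + N ≡ N * N
    MMN = begin
      M + M + N ≡⟨ cong (_+ N) (sym (trans (∑-comm {N} {M} _) (trans (sum-cong-≗ {M} (λ e → endsSum N e 1)) (trans (∑-distrib-+ {M} _ _) (cong₂ _+_ (trans (S-const M 1) (*-identityʳ M)) (trans (S-const M 1) (*-identityʳ M))))))) ⟩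
      S N (deg N) + N ≡⟨ cong (S N (deg N) +_) (sym (trans (S-const N 1) (*-identityʳ N))) ⟩
      S N (deg N) + S N (λ _ → 1) ≡⟨ +-comm (S N (deg N)) _ ⟩
      S N (λ _ → 1) + S N (deg N) ≡⟨ sym (∑-distrib-+ {N} (λ _ → 1) (deg N)) ⟩
      S N (λ v → suc (deg N v)) ≡⟨ sum-cong-≗ {N} (deg+1 N) ⟩
      S N (λ _ → N) ≡⟨ S-const N N ⟩
      N * N ∎
      where open ≡-Reasoning

    f0 f1 : Fin 2
    f0 = Fin.zero
    f1 = Fin.suc Fin.zero

    cnt1 : count γ f1 ≡ x + y
    cnt1 = trans (countS γ f1) (cong₂ _+_ (sum-cong-≗ {N} (λ v → ind1 (vcol γ v))) (sum-cong-≗ {M} (λ e → ind1 (ecol γ e))))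

    cnt01 : count γ f0 + count γ f1 ≡ N + M
    cnt01 = begin
      count γ f0 + count γ f1 ≡⟨ cong₂ _+_ (countS γ f0) (countS γ f1) ⟩
      (A0 + B0) + (A1 + B1) ≡⟨ l A0 B0 A1 B1 ⟩
      (A0 + A1) + (B0 + B1) ≡⟨ cong₂ _+_ (trans (sym (∑-distrib-+ {N} _ _)) (trans (sum-cong-≗ {N} (λ v → ind01 (vcol γ v))) (trans (S-const N 1) (*-identityʳ N))))
                                          (trans (sym (∑-distrib-+ {M} _ _)) (trans (sum-cong-≗ {M} (λ e → ind01 (ecol γ e))) (trans (S-const M 1) (*-identityʳ M)))) ⟩
      N + M ∎
      where
      open ≡-Reasoning
      A0 B0 A1 B1 : ℕ
      A0 = S N (λ v → ind (vcol γ v) f0)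
      B0 = S M (λ e → ind (ecol γ e) f0)
      A1 = S N (λ v → ind (vcol γ v) f1)
      B1 = S M (λ e → ind (ecol γ e) f1)
      l : ∀ a b c e → (a + b) + (c + e) ≡ (a + c) + (b + e)
      l = solve-∀

    bvTwoZeros : ∀ a b → a ≢ b → bv a ≡ 0 → bv b ≡ 0 → x + 2 ≤ N
    bvTwoZeros a b ne ba bb = ≤-trans (+-monoʳ-≤ x (≤-trans (≤-reflexive (cong₂ _+_ (cong (1 ∸_) (sym ba)) (cong (1 ∸_) (sym bb)))) (S-ge2 N (λ v → 1 ∸ bv v) a b ne)))
      (≤-reflexive (trans (sym (∑-distrib-+ {N} bv (λ v → 1 ∸ bv v))) (trans (sum-cong-≗ {N} (λ v → m+[n∸m]≡n (fin2≤1 (vcol γ v)))) (trans (S-const N 1) (*-identityʳ N)))))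

    bvTwoOnes : ∀ a b → a ≢ b → bv a ≡ 1 → bv b ≡ 1 → 2 ≤ x
    bvTwoOnes a b ne ba bb = ≤-trans (≤-reflexive (sym (cong₂ _+_ ba bb))) (S-ge2 N bv a b ne)

    lits : ∀ N → 3 ≤ N → (N ≢ 0) × (N ≢ 1) × (N ∸ 1 ≢ 0) × (N ≢ N ∸ 1) × (1 ≢ N ∸ 1)
    lits (suc (suc (suc n))) (s≤s (s≤s (s≤s _))) = (λ ()) , (λ ()) , (λ ()) , (λ e → <-irrefl (sym e) (n<1+n _)) , (λ { () })

    N≢0 : N ≢ 0
    N≢0 = proj₁ (lits N N≥3)
    N≢1 : N ≢ 1
    N≢1 = proj₁ (proj₂ (lits N N≥3))
    N∸1≢0 : N ∸ 1 ≢ 0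
    N∸1≢0 = proj₁ (proj₂ (proj₂ (lits N N≥3)))
    N≢N∸1 : N ≢ N ∸ 1
    N≢N∸1 = proj₁ (proj₂ (proj₂ (proj₂ (lits N N≥3))))
    1≢N∸1 : 1 ≢ N ∸ 1
    1≢N∸1 = proj₂ (proj₂ (proj₂ (proj₂ (lits N N≥3))))

    1≤N : 1 ≤ N
    1≤N = ≤-trans (s≤s z≤n) N≥3

    1≢0 : 1 ≢ 0
    1≢0 ()

    dne : ∀ {a b} → d a ≢ d b → a ≢ b
    dne h refl = h refl

    -- If some vertex z has d z = 0 then no vertex has d = N: the edge joining
    -- them would have to be coloured 1 and 2 at once.
    noTop : ∀ z → d z ≡ 0 → ∀ v → d v ≢ N
    noTop z dz t dt with edgeBetween N t z (dne (λ e → N≢0 (trans (sym dt) (trans e dz))))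
    ... | e , c = 1≢0 (trans (sym (zerZero t e (proj₁ (topZer t dt)) (connInc c))) (oneZero z e (proj₁ (botOne z dz)) (connInc (connSym c))))

    -- If d < N everywhere then Σ d ≤ N(N-1)/2 = M, and the equitability of the
    -- colour classes forces all but at most one vertex to get colour 2.
    fewLowVertices : (∀ v → d v < N) → N ≤ suc x
    fewLowVertices d<N = +-cancelʳ-≤ M N (suc x) (≤-trans h1 (≤-trans (≤-reflexive (l x y)) (s≤s (+-monoʳ-≤ x h2))))
      where
      h2 : x + (y + y) ≤ M
      h2 = *-cancelʳ-≤ (x + (y + y)) M 2 (+-cancelʳ-≤ N _ _ (≤-trans (≤-reflexive (cong (λ z → z * 2 + N) (sym sumd)))
        (≤-trans (injectiveSumBound N d dinj d<N) (≤-reflexive (trans (sym MMN) (cong (_+ N) (l' M)))))))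
        where l' : ∀ M → M + M ≡ M * 2
              l' = solve-∀
      h1 : N + M ≤ suc ((x + y) + (x + y))
      h1 = ≤-trans (≤-reflexive (sym cnt01)) (≤-trans (+-monoˡ-≤ (count γ f1) (eqt f0 f1)) (≤-reflexive (cong (λ z → suc z + z) cnt1)))
      l : ∀ x y → suc ((x + y) + (x + y)) ≡ suc (x + (x + (y + y)))
      l = solve-∀

    -- If d > 0 everywhere then Σ d ≥ M + N, and equitability leaves at most one
    -- vertex with colour 2.
    fewHighVertices : (∀ v → d v ≢ 0) → x ≤ 1
    fewHighVertices nz = +-cancelʳ-≤ (x + (y + y)) x 1 (≤-trans (≤-reflexive (l x y)) (≤-trans h (s≤s (≤-trans (≤-reflexive (+-comm N M)) big))))
      where
      l : ∀ x y → x + (x + (y + y)) ≡ (x + y) + (x + y)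
      l = solve-∀
      h : (x + y) + (x + y) ≤ suc (N + M)
      h = ≤-trans (≤-reflexive (sym (cong₂ _+_ cnt1 cnt1))) (≤-trans (+-monoʳ-≤ (count γ f1) (eqt f1 f0))
        (≤-reflexive (trans (+-suc (count γ f1) (count γ f0)) (cong suc (trans (+-comm (count γ f1) (count γ f0)) cnt01)))))
      ev : Fin N → ℕ
      ev v = N ∸ d v
      evinj : Injective _≡_ _≡_ ev
      evinj {a} {b} h = dinj (∸-cancelˡ-≡ (d≤N a) (d≤N b) h)
      split : S N ev + S N d ≡ N * N
      split = trans (sym (∑-distrib-+ {N} ev d)) (trans (sum-cong-≗ {N} (λ v → m∸n+n≡m (d≤N v))) (S-const N N))
      big : M + N ≤ x + (y + y)
      big = ≤-trans (*-cancelʳ-≤ (M + N) (S N d) 2 step) (≤-reflexive sumd)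
        where
        open ≤-Reasoning
        Se Sd : ℕ
        Se = S N ev
        Sd = S N d
        step0 : N * N + (N * N + N) ≤ N * N + Sd * 2
        step0 = begin
          N * N + (N * N + N)   ≡⟨ l1 (N * N) N ⟩
          (N * N) * 2 + N       ≡⟨ cong (λ z → z * 2 + N) (sym split) ⟩
          (Se + Sd) * 2 + N     ≡⟨ l2 Se Sd N ⟩
          Se * 2 + N + Sd * 2   ≤⟨ +-monoˡ-≤ (Sd * 2) (injectiveSumBound N ev evinj (λ v → ∸-monoʳ-< (n≢0⇒n>0 (nz v)) (d≤N v))) ⟩
          N * N + Sd * 2        ∎
          where l1 : ∀ a n → a + (a + n) ≡ a * 2 + n
                l1 = solve-∀
                l2 : ∀ a b n → (a + b) * 2 + n ≡ a * 2 + n + b * 2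
                l2 = solve-∀
        step : (M + N) * 2 ≤ Sd * 2
        step = ≤-trans (≤-reflexive (trans (l3 M N) (cong (_+ N) MMN))) (+-cancelˡ-≤ (N * N) _ _ step0)
          where l3 : ∀ M N → (M + N) * 2 ≡ M + M + N + N
                l3 = solve-∀

    -- Case d z = 0.  Let d w1 = 1 and d w2 = N - 1.  All vertices but z have
    -- colour 2, so w1 has only edges of colour 1, in particular w1w2; z too, in
    -- particular w2z.  But then w2 sees two edges of colour 1 while it may see only one.
    caseZ : (z : Fin N) → d z ≡ 0 → ⊥
    caseZ z dz = <-irrefl refl (≤-trans (zerAt2 w2 e12 e2z e12≢e2z (connInc (connSym c12)) (connInc c2z) b12 b2z) (≤-reflexive zer1))
      where
      botz : one z ≡ 0 × bv z ≡ 0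
      botz = botOne z dz
      xbig : N ≤ suc x
      xbig = fewLowVertices (λ v → ≤∧≢⇒< (d≤N v) (noTop z dz v))
      W1 : Σ (Fin N) (λ i → d i ≡ 1)
      W1 = present N d dinj d≤N N 1 ≤-refl 1≤N N≢1 (noTop z dz)
      W2 : Σ (Fin N) (λ i → d i ≡ N ∸ 1)
      W2 = present N d dinj d≤N N (N ∸ 1) ≤-refl (m∸n≤m N 1) N≢N∸1 (noTop z dz)
      w1 w2 : Fin N
      w1 = proj₁ W1
      w2 = proj₁ W2
      w1≢z : w1 ≢ z
      w1≢z = dne (λ e → 1≢0 (trans (sym (proj₂ W1)) (trans e dz)))
      w2≢z : w2 ≢ z
      w2≢z = dne (λ e → N∸1≢0 (trans (sym (proj₂ W2)) (trans e dz)))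
      w1≢w2 : w1 ≢ w2
      w1≢w2 = dne (λ e → 1≢N∸1 (trans (sym (proj₂ W1)) (trans e (proj₂ W2))))
      bvOne : ∀ w → w ≢ z → bv w ≡ 1
      bvOne w ne with n≤1⇒n≡0∨n≡1 (fin2≤1 (vcol γ w))
      ... | inj₂ p = p
      ... | inj₁ p = ⊥-elim (<-irrefl refl (≤-trans (≤-reflexive (+-comm 2 x)) (≤-trans (bvTwoZeros z w (λ e → ne (sym e)) (proj₂ botz) p) xbig)))
      one1 : one w1 ≡ 0
      one1 = +-cancelˡ-≡ 1 (one w1) 0 (trans (cong (_+ one w1) (sym (bvOne w1 w1≢z))) (proj₂ W1))
      zer1 : zer w2 ≡ 1
      zer1 = +-cancelˡ-≡ (one w2) (zer w2) 1 (trans (one+zer w2) (trans (degN w2) (trans (sym (proj₂ W2)) (trans (cong (_+ one w2) (bvOne w2 w2≢z)) (+-comm 1 (one w2))))))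
      e12 : Fin M
      e12 = proj₁ (edgeBetween N w1 w2 w1≢w2)
      c12 : Conn N w1 w2 e12
      c12 = proj₂ (edgeBetween N w1 w2 w1≢w2)
      e2z : Fin M
      e2z = proj₁ (edgeBetween N w2 z w2≢z)
      c2z : Conn N w2 z e2z
      c2z = proj₂ (edgeBetween N w2 z w2≢z)
      b12 : be e12 ≡ 0
      b12 = oneZero w1 e12 one1 (connInc c12)
      b2z : be e2z ≡ 0
      b2z = oneZero z e2z (proj₁ botz) (connInc (connSym c2z))
      e12≢e2z : e12 ≢ e2z
      e12≢e2z = connDiff c12 c2z w1≢z (λ e → w1≢w2 (sym e))

    -- Case d > 0.  Let d t = N, d w2 = N - 1 and d w1 = 1.  The top vertex t has
    -- colour 2 and only edges of colour 2; as at most one vertex has colour 2, w2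
    -- has colour 1 and so also only edges of colour 2.  Then w1 sees the two edges
    -- w1t and w1w2 of colour 2, although d w1 = 1.
    caseNZ : (∀ v → d v ≢ 0) → ⊥
    caseNZ nz = <-irrefl refl (≤-trans (≤-trans (oneAt2 w1 e1t e12 e1t≢e12 (connInc c1t) (connInc c12) b1t b12) (m≤n+m (one w1) (bv w1))) (≤-reflexive (proj₂ W1)))
      where
      T0 : Σ (Fin N) (λ i → d i ≡ N)
      T0 = present N d dinj d≤N 0 N z≤n ≤-refl (λ e → N≢0 (sym e)) nz
      W1 : Σ (Fin N) (λ i → d i ≡ 1)
      W1 = present N d dinj d≤N 0 1 z≤n 1≤N (λ ()) nz
      W2 : Σ (Fin N) (λ i → d i ≡ N ∸ 1)
      W2 = present N d dinj d≤N 0 (N ∸ 1) z≤n (m∸n≤m N 1) (λ e → N∸1≢0 (sym e)) nz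
      t : Fin N
      t = proj₁ T0
      w1 w2 : Fin N
      w1 = proj₁ W1
      w2 = proj₁ W2
      top : zer t ≡ 0 × bv t ≡ 1
      top = topZer t (proj₂ T0)
      w2≢t : w2 ≢ t
      w2≢t = dne (λ e → N≢N∸1 (trans (sym (proj₂ T0)) (trans (sym e) (proj₂ W2))))
      w1≢t : w1 ≢ t
      w1≢t = dne (λ e → N≢1 (trans (sym (proj₂ T0)) (trans (sym e) (proj₂ W1))))
      w1≢w2 : w1 ≢ w2
      w1≢w2 = dne (λ e → 1≢N∸1 (trans (sym (proj₂ W1)) (trans e (proj₂ W2))))
      bv2 : bv w2 ≡ 0
      bv2 with n≤1⇒n≡0∨n≡1 (fin2≤1 (vcol γ w2))
      ... | inj₁ p = p
      ... | inj₂ p = ⊥-elim (<-irrefl refl (≤-trans (bvTwoOnes t w2 (λ e → w2≢t (sym e)) (proj₂ top) p) (fewHighVertices nz)))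
      zer2 : zer w2 ≡ 0
      zer2 = +-cancelˡ-≡ (one w2) (zer w2) 0 (trans (one+zer w2) (trans (degN w2) (trans (sym (proj₂ W2)) (trans (cong (_+ one w2) bv2) (sym (+-identityʳ (one w2)))))))
      e1t : Fin M
      e1t = proj₁ (edgeBetween N w1 t w1≢t)
      c1t : Conn N w1 t e1t
      c1t = proj₂ (edgeBetween N w1 t w1≢t)
      e12 : Fin M
      e12 = proj₁ (edgeBetween N w1 w2 w1≢w2)
      c12 : Conn N w1 w2 e12
      c12 = proj₂ (edgeBetween N w1 w2 w1≢w2)
      b1t : be e1t ≡ 1
      b1t = zerZero t e1t (proj₁ top) (connInc (connSym c1t))
      b12 : be e12 ≡ 1
      b12 = zerZero w2 e12 zer2 (connInc (connSym c12))
      e1t≢e12 : e1t ≢ e12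
      e1t≢e12 = connDiff (connSym c1t) c12 (λ e → w2≢t (sym e)) w1≢t

    noColouring : ⊥
    noColouring with any? (λ v → d v ≟ 0)
    ... | yes (z , dz) = caseZ z dz
    ... | no nz = caseNZ (λ v e → nz (v , e))

  noColouring0 : ∀ N → 1 ≤ N → ¬ AdmitsENSDT (K N) 0
  noColouring0 (suc N) _ (γ , _) with vcol γ Fin.zero
  ... | ()

  -- With one colour every vertex has σ = 1 + (N - 1) = N.
  noColouring1 : ∀ N → 2 ≤ N → ¬ AdmitsENSDT (K N) 1
  noColouring1 N h (γ , nsd , _) = nsd e (trans (σN _) (sym (σN _)))
    where
    fin1 : ∀ (x : Fin 1) → toℕ x ≡ 0
    fin1 Fin.zero = refl
    0≢1 : Fin.fromℕ< (≤-trans (s≤s z≤n) h) ≢ Fin.fromℕ< h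
    0≢1 eq = 0≢1+n (trans (sym (toℕ-fromℕ< (≤-trans (s≤s z≤n) h))) (trans (cong toℕ eq) (toℕ-fromℕ< h)))
    e : Fin (m (K N))
    e = proj₁ (edgeBetween N _ _ 0≢1)
    σN : ∀ v → σT γ v ≡ N
    σN v = trans (sigmaS γ v) (trans (cong₂ (λ a b → suc a + b) (fin1 (vcol γ v))
      (sum-cong-≗ {m (K N)} (λ e → cong (incS N v e) (cong suc (fin1 (ecol γ e)))))) (deg+1 N v))

  noColouring2 : ∀ N → 3 ≤ N → ¬ AdmitsENSDT (K N) 2
  noColouring2 N h (γ , nsd , eqt) = NoTwoColouring.noColouring N h γ nsd eqt

module SmallCases where

  open import Data.Nat using (_≤?_; suc)
  open import Data.Nat.Properties using (_≟_)
  open import Data.Fin using (zero; suc)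
  open import Data.Fin.Properties using (all?)
  open import Data.Product using (_,_; proj₁; proj₂)
  open import Relation.Nullary using (Dec; ¬?)
  open import Relation.Nullary.Decidable using (from-yes)
  open import Defs

  -- Both defining properties are decidable for a concrete colouring, so for the
  -- small complete graphs they are verified by evaluation.
  nsd? : ∀ {G k} (γ : TotalColouring G k) → Dec (NeighbourSumDistinguishing γ)
  nsd? {G} γ = all? (λ i → ¬? (σT γ (proj₁ (edge G i)) ≟ σT γ (proj₂ (edge G i))))

  equitable? : ∀ {G k} (γ : TotalColouring G k) → Dec (Equitable γ)
  equitable? γ = all? (λ c → all? (λ d → count γ c ≤? suc (count γ d)))

  adm2 : AdmitsENSDT (K 2) 2
  adm2 = γ , from-yes (nsd? γ) , from-yes (equitable? γ)
    where
    γ : TotalColouring (K 2) 2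
    γ = record { vcol = λ { zero → zero ; (suc zero) → suc zero } ; ecol = λ _ → zero }

  adm3 : AdmitsENSDT (K 3) 3
  adm3 = γ , from-yes (nsd? γ) , from-yes (equitable? γ)
    where
    γ : TotalColouring (K 3) 3
    γ = record
      { vcol = λ { zero → zero ; (suc zero) → zero ; (suc (suc zero)) → suc (suc zero) }
      ; ecol = λ { zero → suc zero ; (suc zero) → suc zero ; (suc (suc zero)) → suc (suc zero) } }

  adm4 : AdmitsENSDT (K 4) 3
  adm4 = γ , from-yes (nsd? γ) , from-yes (equitable? γ)
    where
    γ : TotalColouring (K 4) 3
    γ = record
      { vcol = λ { (suc (suc (suc zero))) → suc zero ; _ → zero }
      ; ecol = λ { zero → zero ; (suc zero) → suc zero ; (suc (suc zero)) → suc zero ; _ → suc (suc zero) } }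

open import Data.Nat using (suc; _<_; _+_; s≤s; z≤n)
open import Data.Nat.Properties using (≤-trans)
open import Data.Product using (_,_)
open import Relation.Nullary using (¬_)
open SmallCases
open Construction using (upperBound5)
open TwoColourLowerBound using (noColouring0; noColouring1; noColouring2)

upperBound : ∀ N → 3 ≤ N → AdmitsENSDT (K N) 3
upperBound 1 (s≤s ())
upperBound 2 (s≤s (s≤s ()))
upperBound 3 _ = adm3
upperBound 4 _ = adm4
upperBound (suc (suc (suc (suc (suc n))))) _ = upperBound5 (5 + n) (s≤s (s≤s (s≤s (s≤s (s≤s z≤n)))))

lowerBound : ∀ N → 3 ≤ N → ∀ j → j < 3 → ¬ AdmitsENSDT (K N) j
lowerBound N h 0 _ = noColouring0 N (≤-trans (s≤s z≤n) h)
lowerBound N h 1 _ = noColouring1 N (≤-trans (s≤s (s≤s z≤n)) h)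
lowerBound N h 2 _ = noColouring2 N h
lowerBound N h (suc (suc (suc j))) (s≤s (s≤s (s≤s ())))

lowerBoundK2 : ∀ j → j < 2 → ¬ AdmitsENSDT (K 2) j
lowerBoundK2 0 _ = noColouring0 2 (s≤s z≤n)
lowerBoundK2 1 _ = noColouring1 2 (s≤s (s≤s z≤n))
lowerBoundK2 (suc (suc j)) (s≤s (s≤s ()))

theorem5 : ((N : ℕ) → 3 ≤ N → EquitableNSDTotalChromatic (K N) 3)
  × EquitableNSDTotalChromatic (K 2) 2
theorem5 = (λ N h → upperBound N h , lowerBound N h) , (adm2 , lowerBoundK2)
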